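{- Let $n>1$ and $k \in \{4,5,6,8\}$. If there exists a transversal design TD$(k,n)$, then there exists an SBGDD$_0$ of type $n^k$.
   Context: A transversal design TD$(k,n)$ is a set $V$ of $kn$ points partitioned into $k$ groups of size $n$, together with a collection of $k$-element blocks, such that two points in the same group lie in no common block and two points in different groups lie in exactly one common block. For a multiset $\mathcal{B}$ of subsets of a set $V$ and $X \subseteq V$, the frequency of $X$ is the number of members of $\mathcal{B}$ (counted with multiplicity) containing $X$. An SBGDD$_\mu$ of type $g^u$ is a triple $(V,\Pi,\mathcal{B})$ where $V$ is a set of $gu$ points, $\Pi$ is a partition of $V$ into $u$ groups each of size $g$, and $\mathcal{B}$ is a multiset of 3-element subsets of $V$, such that every pair of points in the same group has frequency $0$, and the frequencies of pairs of points in different groups are pairwise distinct and form exactly the set $\{\mu,\dots,\mu+g^2\binom{u}{2}-1\}$. -}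

module Defs where

open import Data.Nat using (ℕ; zero; suc; _+_; _*_; _<_; _≤_)
open import Data.Nat.Combinatorics using (_C_)
open import Data.Fin using (Fin)
import Data.Fin as Fin
open import Data.Product using (_×_; _,_; proj₁; Σ; ∃)
open import Data.Product.Properties using (≡-dec)
open import Data.Sum using (_⊎_)
open import Data.List using (List; length; filter)
open import Data.List.Relation.Unary.Unique.Propositional using (Unique)
open import Data.List.Membership.DecPropositional using (_∈?_)
import Data.List.Membership.Propositional as Mem
open import Relation.Binary.PropositionalEquality using (_≡_; _≢_)
open import Relation.Binary.Definitions using (DecidableEquality)
open import Relation.Nullary using (¬_)
open import Relation.Nullary.Decidable using (_×-dec_)

Point : ℕ → ℕ → Set
Point k n = Fin k × Fin n

group : ∀ {k n} → Point k n → Fin k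
group = proj₁

_≟P_ : ∀ {k n} → DecidableEquality (Point k n)
_≟P_ = ≡-dec Fin._≟_ Fin._≟_

-- A block is a finite subset of points, represented by a duplicate-free list.
Block : ℕ → ℕ → Set
Block k n = List (Point k n)

IsSubsetOfSize : ∀ {k n} → ℕ → Block k n → Set
IsSubsetOfSize s B = Unique B × length B ≡ s

freq : ∀ {k n} → List (Block k n) → Point k n → Point k n → ℕ
freq {k} {n} ℬ p q =
  length (filter (λ B → _∈?_ _≟P_ p B ×-dec _∈?_ _≟P_ q B) ℬ)

record TD (k n : ℕ) : Set where
  field
    blocks     : List (Block k n)
    blockSize  : ∀ {B} → B Mem.∈ blocks → IsSubsetOfSize k B
    sameGroup  : ∀ p q → p ≢ q → group p ≡ group q → freq blocks p q ≡ 0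
    diffGroup  : ∀ p q → group p ≢ group q → freq blocks p q ≡ 1

record SBGDD (μ n k : ℕ) : Set where
  field
    blocks     : List (Block k n)
    blockSize  : ∀ {B} → B Mem.∈ blocks → IsSubsetOfSize 3 B
    sameGroup  : ∀ p q → p ≢ q → group p ≡ group q → freq blocks p q ≡ 0
    distinct   : ∀ p q p′ q′ → group p ≢ group q → group p′ ≢ group q′ →
                 freq blocks p q ≡ freq blocks p′ q′ →
                 (p ≡ p′ × q ≡ q′) ⊎ (p ≡ q′ × q ≡ p′)
    inRange    : ∀ p q → group p ≢ group q →
                 μ ≤ freq blocks p q × freq blocks p q < μ + n * n * (k C 2)
    onto       : ∀ m → μ ≤ m → m < μ + n * n * (k C 2) →
                 Σ (Point k n) λ p → Σ (Point k n) λ q →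
                   group p ≢ group q × freq blocks p q ≡ m

{-# OPTIONS --safe #-}
module Submission where

-- Fix two groups g₀ , g₁ of the TD.  Its blocks are indexed by their points (a , b) in these
-- groups, and every pair of points in different groups lies in exactly one of them.  Inside
-- each block we place a multiset of triples, so the frequency of a cross pair is the weight of
-- the corresponding edge {u , v} of K_k in the multiset of its block, and it suffices to make
-- (block , edge) ↦ weight a bijection onto {0, …, n² C(k,2) - 1}.  With the block index
-- j = r + q P, block j gets a base multiset for the residue r plus q copies of the complete
-- triple system, whose edge weights are all P C(k,2); the P base multisets realise every
-- label below P C(k,2) exactly once.  For k = 5, 8 (P = 3) and k = 6 (P = 4) the incomplete
-- last period is harmless since n² mod P ∈ {0 , 1}; for k = 4 (P = 1) a parity obstruction
-- is removed by extra blocks.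

open import Defs
open import Function using (_∘_; case_of_)
open import Data.Empty using (⊥; ⊥-elim)
open import Data.Nat as ℕ using (ℕ; zero; suc; _+_; _*_; _∸_; _≤_; _<_; _<?_; z≤n; s≤s; NonZero; _%_; _/_)
open import Data.Nat.Properties
open import Algebra.Properties.CommutativeSemigroup +-commutativeSemigroup using (xy∙z≈xz∙y; xy∙z≈y∙xz)
open import Data.Nat.ListAction using (sum)
open import Data.Nat.Combinatorics using (_C_)
open import Data.Nat.DivMod using (n%1≡0; n/1≡n; m≡m%n+[m/n]*n; m%n<n; [m+kn]%n≡m%n; %-distribˡ-*; m<n⇒m%n≡m; +-distrib-/-∣ʳ; m<n⇒m/n≡0; m*n/n≡m)
open import Data.Nat.Divisibility using (n∣m*n)
open import Data.Nat.Tactic.RingSolver using (solve-∀)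
open import Data.Fin as Fin using (Fin; #_)
open import Data.Fin.Properties using (all?; toℕ-combine; toℕ<n; toℕ-fromℕ<; toℕ-injective; combine-remQuot; combine-injective)
open import Data.Product using (∃-syntax; _×_; _,_; proj₁; proj₂; swap)
open import Data.Sum using (_⊎_; inj₁; inj₂)
open import Data.List using (List; []; _∷_; _++_; length; filter; map; concat; replicate; allFin; cartesianProduct; head; drop)
open import Data.Maybe using (fromMaybe)
open import Data.List.Properties using (filter-++; length-++; filter-none; filter-some; filter-all; filter-accept; filter-reject; filter-≐; length-replicate; length-removeAt′; length-tabulate; map-∘)
open import Data.List.Membership.Propositional using (_∈_; find; lose)
open import Data.List.Membership.Propositional.Properties using (∈-allFin; ∈-map⁻; ∈-++⁻; ∈-concat⁻′; ∈-cartesianProduct⁺)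
open import Data.List.Membership.DecPropositional using (_∈?_)
open import Data.List.Relation.Unary.Any as Any using (here; there; _─_)
open import Data.List.Relation.Unary.All as All using (All; []; _∷_)
open import Data.List.Relation.Unary.All.Properties using (replicate⁺; ++⁺)
open import Data.List.Relation.Unary.AllPairs using ([]; _∷_)
open import Data.List.Relation.Unary.Unique.Propositional using (Unique)
open import Data.List.Relation.Unary.Unique.Propositional.Properties using (cartesianProduct⁺; allFin⁺)
open import Relation.Nullary using (¬_; Dec; yes; no; ¬?)
open import Relation.Nullary.Decidable using (_×-dec_; _⊎-dec_; _→-dec_; map′; toWitness)
open import Data.Unit using (tt)
open import Relation.Unary using (Decidable; _≐_)
open import Relation.Binary.Definitions using (tri<; tri≈; tri>)
open import Relation.Binary.PropositionalEquality using (_≡_; _≢_; refl; sym; trans; cong; cong₂; subst; ≢-sym; module ≡-Reasoning)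

module _ {A : Set} {P : A → Set} (P? : Decidable P) where

  count : List A → ℕ
  count xs = length (filter P? xs)

  count-++ : ∀ xs ys → count (xs ++ ys) ≡ count xs + count ys
  count-++ xs ys = trans (cong length (filter-++ P? xs ys)) (length-++ (filter P? xs))

  count-concat : ∀ xss → count (concat xss) ≡ sum (map count xss)
  count-concat []         = refl
  count-concat (xs ∷ xss) = trans (count-++ xs (concat xss)) (cong (count xs +_) (count-concat xss))

  count-replicate⁺ : ∀ m {x} → P x → count (replicate m x) ≡ m
  count-replicate⁺ m px = trans (cong length (filter-all P? (replicate⁺ m px))) (length-replicate m)

  count-replicate⁻ : ∀ m {x} → ¬ P x → count (replicate m x) ≡ 0
  count-replicate⁻ m ¬px = cong length (filter-none P? (replicate⁺ m ¬px))

  count-none : ∀ {xs} → (∀ {x} → x ∈ xs → ¬ P x) → count xs ≡ 0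
  count-none ¬P = cong length (filter-none P? (All.tabulate ¬P))

  count≡0⇒¬ : ∀ {x xs} → count xs ≡ 0 → x ∈ xs → ¬ P x
  count≡0⇒¬ c≡0 x∈xs px = <-irrefl refl (subst (0 <_) c≡0 (filter-some P? (lose x∈xs px)))

  count-witness : ∀ xs → 0 < count xs → ∃[ x ] x ∈ xs × P x
  count-witness (x ∷ xs) pos with P? x
  ... | yes px = x , here refl , px
  ... | no  _  = let y , y∈xs , py = count-witness xs pos in y , there y∈xs , py

  count≡1⇒unique : ∀ xs → count xs ≡ 1 → ∀ {x y} → x ∈ xs → P x → y ∈ xs → P y → x ≡ y
  count≡1⇒unique (z ∷ xs) c≡1 x∈ px y∈ py with P? z | x∈ | y∈
  ... | _      | here refl | here refl = refl
  ... | yes _  | here refl | there y∈′ = ⊥-elim (count≡0⇒¬ (suc-injective c≡1) y∈′ py)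
  ... | yes _  | there x∈′ | _         = ⊥-elim (count≡0⇒¬ (suc-injective c≡1) x∈′ px)
  ... | no ¬pz | here refl | _         = ⊥-elim (¬pz px)
  ... | no ¬pz | there _   | here refl = ⊥-elim (¬pz py)
  ... | no _   | there x∈′ | there y∈′ = count≡1⇒unique xs c≡1 x∈′ px y∈′ py

  unique⇒count≡1 : ∀ {x xs} → Unique xs → x ∈ xs → P x → (∀ {y} → y ∈ xs → P y → y ≡ x) → count xs ≡ 1
  unique⇒count≡1 {xs = z ∷ xs} (z∉xs ∷ _) (here refl) px only =
    trans (cong length (filter-accept P? px))
          (cong suc (count-none λ y∈ py → All.lookup z∉xs y∈ (sym (only (there y∈) py))))
  unique⇒count≡1 {xs = z ∷ xs} (z∉xs ∷ u) (there x∈) px only =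
    trans (cong length (filter-reject P? λ pz → All.lookup z∉xs x∈ (only (here refl) pz)))
          (unique⇒count≡1 u x∈ px (only ∘ there))

count-map : ∀ {A B : Set} {P : B → Set} (P? : Decidable P) (f : A → B) xs →
            count P? (map f xs) ≡ count (P? ∘ f) xs
count-map P? f []       = refl
count-map P? f (x ∷ xs) with P? (f x)
... | yes _ = cong suc (count-map P? f xs)
... | no  _ = count-map P? f xs

count-≐ : ∀ {A : Set} {P Q : A → Set} (P? : Decidable P) (Q? : Decidable Q) → P ≐ Q →
          ∀ xs → count P? xs ≡ count Q? xs
count-≐ P? Q? P≐Q xs = cong length (filter-≐ P? Q? P≐Q xs)

module _ {A : Set} (f : A → ℕ) where

  sum-map-zero : ∀ {xs} → (∀ {y} → y ∈ xs → f y ≡ 0) → sum (map f xs) ≡ 0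
  sum-map-zero {[]}     _   = refl
  sum-map-zero {x ∷ xs} f≡0 rewrite f≡0 (here refl) = sum-map-zero (f≡0 ∘ there)

  sum-map-single : ∀ {x xs} → Unique xs → x ∈ xs → (∀ {y} → y ∈ xs → y ≢ x → f y ≡ 0) →
                   sum (map f xs) ≡ f x
  sum-map-single {xs = z ∷ xs} (z∉xs ∷ _) (here refl) f≡0 =
    trans (cong (f z +_) (sum-map-zero λ y∈ → f≡0 (there y∈) (≢-sym (All.lookup z∉xs y∈))))
          (+-identityʳ (f z))
  sum-map-single {xs = z ∷ xs} (z∉xs ∷ u) (there x∈) f≡0 =
    trans (cong (_+ sum (map f xs)) (f≡0 (here refl) (All.lookup z∉xs x∈)))
          (sum-map-single u x∈ (f≡0 ∘ there))

module _ {A : Set} where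

  ∈-─ : ∀ {x y} {ys : List A} (x∈ys : x ∈ ys) → y ∈ ys → y ≢ x → y ∈ (ys ─ x∈ys)
  ∈-─ (here refl) (here refl) y≢x = ⊥-elim (y≢x refl)
  ∈-─ (here refl) (there y∈)  _   = y∈
  ∈-─ (there _)   (here refl) _   = here refl
  ∈-─ (there x∈)  (there y∈)  y≢x = there (∈-─ x∈ y∈ y≢x)

  injective-on⇒length≤ : ∀ {B : Set} (f : B → A) {xs ys} → Unique xs →
                         (∀ {x y} → x ∈ xs → y ∈ xs → f x ≡ f y → x ≡ y) →
                         (∀ {x} → x ∈ xs → f x ∈ ys) → length xs ≤ length ys
  injective-on⇒length≤ f {[]}     _          _   _    = z≤n
  injective-on⇒length≤ f {x ∷ xs} {ys} (x∉xs ∷ u) inj into = begin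
    suc (length xs)             ≤⟨ s≤s (injective-on⇒length≤ f u (λ x∈ y∈ → inj (there x∈) (there y∈)) into′) ⟩
    suc (length (ys ─ fx∈ys))   ≡⟨ sym (length-removeAt′ ys (Any.index fx∈ys)) ⟩
    length ys                   ∎
    where
    open ≤-Reasoning
    fx∈ys = into (here refl)
    into′ : ∀ {y} → y ∈ xs → f y ∈ (ys ─ fx∈ys)
    into′ y∈ = ∈-─ fx∈ys (into (there y∈)) λ fy≡fx →
      All.lookup x∉xs y∈ (sym (inj (there y∈) (here refl) fy≡fx))

-- Transversal designs

-- freq ℬ p q unfolds to count (pair∈? p q) ℬ.
pair∈? : ∀ {k n} (p q : Point k n) → Decidable (λ B → p ∈ B × q ∈ B)
pair∈? p q B = _∈?_ _≟P_ p B ×-dec _∈?_ _≟P_ q B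

count-pair-swap : ∀ {k n} (p q : Point k n) xs → count (pair∈? p q) xs ≡ count (pair∈? q p) xs
count-pair-swap p q = count-≐ (pair∈? p q) (pair∈? q p) (swap , swap)

module Transversal {k n : ℕ} (td : TD k n) where
  open TD td

  same-group⇒≡ : ∀ {B p q} → B ∈ blocks → p ∈ B → q ∈ B → group p ≡ group q → p ≡ q
  same-group⇒≡ {p = p} {q} B∈ p∈ q∈ gp≡gq with p ≟P q
  ... | yes p≡q = p≡q
  ... | no  p≢q = ⊥-elim (count≡0⇒¬ (pair∈? p q) (sameGroup p q p≢q gp≡gq) B∈ (p∈ , q∈))

  block-through : ∀ p q → group p ≢ group q → ∃[ B ] B ∈ blocks × p ∈ B × q ∈ B
  block-through p q gp≢gq =
    count-witness (pair∈? p q) blocks (subst (0 <_) (sym (diffGroup p q gp≢gq)) (s≤s z≤n))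

  block-unique : ∀ {p q B B′} → group p ≢ group q → B ∈ blocks → p ∈ B → q ∈ B →
                 B′ ∈ blocks → p ∈ B′ → q ∈ B′ → B ≡ B′
  block-unique {p} {q} gp≢gq B∈ p∈ q∈ B′∈ p∈′ q∈′ =
    count≡1⇒unique (pair∈? p q) blocks (diffGroup p q gp≢gq) B∈ (p∈ , q∈) B′∈ (p∈′ , q∈′)

  -- The k points of a block lie in distinct groups, so by pigeonhole they meet all k groups.
  block-meets-group : ∀ {B} → B ∈ blocks → (u : Fin k) → ∃[ x ] (u , x) ∈ B
  block-meets-group {B} B∈ u with Any.any? (λ p → group p Fin.≟ u) B
  ... | yes hit with find hit
  ...   | (_ , x) , x∈B , refl = x , x∈B
  block-meets-group {B} B∈ u | no miss = ⊥-elim (<-irrefl refl k<k)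
    where
    open ≤-Reasoning
    k<k : k < k
    k<k = begin-strict
      k                              ≡⟨ sym (proj₂ (blockSize B∈)) ⟩
      length B                       ≤⟨ injective-on⇒length≤ group (proj₁ (blockSize B∈))
                                          (λ p∈ q∈ → same-group⇒≡ B∈ p∈ q∈)
                                          (λ {p} p∈ → ∈-─ (∈-allFin u) (∈-allFin (group p)) (miss ∘ lose p∈)) ⟩
      length (allFin k ─ ∈-allFin u) <⟨ n<1+n _ ⟩
      suc (length (allFin k ─ ∈-allFin u)) ≡⟨ sym (length-removeAt′ (allFin k) (Any.index (∈-allFin u))) ⟩
      length (allFin k)              ≡⟨ length-tabulate (λ i → i) ⟩
      k                              ∎

  module Coordinates (g₀ g₁ : Fin k) (g₀≢g₁ : g₀ ≢ g₁) where

    -- Opaque: nothing below depends on which block and point were chosen.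
    opaque
      private
        through : (a b : Fin n) → ∃[ B ] B ∈ blocks × (g₀ , a) ∈ B × (g₁ , b) ∈ B
        through a b = block-through (g₀ , a) (g₁ , b) g₀≢g₁

      blockAt : Fin n → Fin n → Block k n
      blockAt a b = proj₁ (through a b)

      blockAt∈ : ∀ a b → blockAt a b ∈ blocks
      blockAt∈ a b = proj₁ (proj₂ (through a b))

      g₀∈blockAt : ∀ a b → (g₀ , a) ∈ blockAt a b
      g₀∈blockAt a b = proj₁ (proj₂ (proj₂ (through a b)))

      g₁∈blockAt : ∀ a b → (g₁ , b) ∈ blockAt a b
      g₁∈blockAt a b = proj₂ (proj₂ (proj₂ (through a b)))

      point : Fin n → Fin n → Fin k → Fin n
      point a b u = proj₁ (block-meets-group (blockAt∈ a b) u)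

      point∈ : ∀ a b u → (u , point a b u) ∈ blockAt a b
      point∈ a b u = proj₂ (block-meets-group (blockAt∈ a b) u)

    point-unique : ∀ {a b u x} → (u , x) ∈ blockAt a b → point a b u ≡ x
    point-unique {a} {b} {u} x∈ = cong proj₂ (same-group⇒≡ (blockAt∈ a b) (point∈ a b u) x∈ refl)

    point-g₀ : ∀ a b → point a b g₀ ≡ a
    point-g₀ a b = point-unique (g₀∈blockAt a b)

    point-g₁ : ∀ a b → point a b g₁ ≡ b
    point-g₁ a b = point-unique (g₁∈blockAt a b)

    point-injective : ∀ {u v a b a′ b′} → u ≢ v → point a b u ≡ point a′ b′ u →
                      point a b v ≡ point a′ b′ v → a ≡ a′ × b ≡ b′
    point-injective {u} {v} {a} {b} {a′} {b′} u≢v eu ev =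
      trans (sym (point-g₀ a b)) (trans (point-unique (moved g₀)) (point-g₀ a′ b′)) ,
      trans (sym (point-g₁ a b)) (trans (point-unique (moved g₁)) (point-g₁ a′ b′))
      where
      same : blockAt a′ b′ ≡ blockAt a b
      same = sym (block-unique u≢v (blockAt∈ a b) (point∈ a b u) (point∈ a b v) (blockAt∈ a′ b′)
                   (subst (λ x → (u , x) ∈ blockAt a′ b′) (sym eu) (point∈ a′ b′ u))
                   (subst (λ x → (v , x) ∈ blockAt a′ b′) (sym ev) (point∈ a′ b′ v)))
      moved : ∀ w → (w , point a′ b′ w) ∈ blockAt a b
      moved w = subst (λ B → (w , point a′ b′ w) ∈ B) same (point∈ a′ b′ w)

    point-surjective : ∀ {u v} → u ≢ v → ∀ x y → ∃[ a ] ∃[ b ] point a b u ≡ x × point a b v ≡ y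
    point-surjective {u} {v} u≢v x y
      with B , B∈ , x∈ , y∈ ← block-through (u , x) (v , y) u≢v
      with a , a∈ ← block-meets-group B∈ g₀ | b , b∈ ← block-meets-group B∈ g₁ =
      a , b , point-unique (subst ((u , x) ∈_) (sym same) x∈) , point-unique (subst ((v , y) ∈_) (sym same) y∈)
      where
      same : blockAt a b ≡ B
      same = block-unique g₀≢g₁ (blockAt∈ a b) (g₀∈blockAt a b) (g₁∈blockAt a b) B∈ a∈ b∈

-- Multisets of triples

Triple : ℕ → Set
Triple k = Fin k × Fin k × Fin k

module _ {k : ℕ} where

  _∈ᵗ_ : Fin k → Triple k → Set
  u ∈ᵗ (a , b , c) = u ≡ a ⊎ u ≡ b ⊎ u ≡ c

  _∈ᵗ?_ : ∀ u t → Dec (u ∈ᵗ t)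
  u ∈ᵗ? (a , b , c) = (u Fin.≟ a) ⊎-dec (u Fin.≟ b) ⊎-dec (u Fin.≟ c)

  covers? : ∀ u v → Decidable (λ t → u ∈ᵗ t × v ∈ᵗ t)
  covers? u v t = (u ∈ᵗ? t) ×-dec (v ∈ᵗ? t)

  Distinct : Triple k → Set
  Distinct (a , b , c) = a ≢ b × a ≢ c × b ≢ c

  distinct? : ∀ t → Dec (Distinct t)
  distinct? (a , b , c) = ¬? (a Fin.≟ b) ×-dec ¬? (a Fin.≟ c) ×-dec ¬? (b Fin.≟ c)

ifYes : ∀ {P : Set} → Dec P → ℕ → ℕ
ifYes (yes _) m = m
ifYes (no  _) _ = 0

Weighted : ℕ → Set
Weighted k = List (ℕ × Triple k)

module _ {k : ℕ} where

  expand : Weighted k → List (Triple k)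
  expand []             = []
  expand ((m , t) ∷ ts) = replicate m t ++ expand ts

  weight : Weighted k → Fin k → Fin k → ℕ
  weight []             u v = 0
  weight ((m , t) ∷ ts) u v = ifYes (covers? u v t) m + weight ts u v

  scale : ℕ → Weighted k → Weighted k
  scale q = map λ (m , t) → q * m , t

  AllDistinct : Weighted k → Set
  AllDistinct ts = All (λ (_ , t) → Distinct t) ts

  count-expand : ∀ ts u v → count (covers? u v) (expand ts) ≡ weight ts u v
  count-expand []             u v = refl
  count-expand ((m , t) ∷ ts) u v with covers? u v t
  ... | yes uv∈t = trans (count-++ (covers? u v) (replicate m t) (expand ts))
                         (cong₂ _+_ (count-replicate⁺ (covers? u v) m uv∈t) (count-expand ts u v))
  ... | no  uv∉t = trans (count-++ (covers? u v) (replicate m t) (expand ts))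
                         (cong₂ _+_ (count-replicate⁻ (covers? u v) m uv∉t) (count-expand ts u v))

  weight-++ : ∀ ts ss u v → weight (ts ++ ss) u v ≡ weight ts u v + weight ss u v
  weight-++ []             ss u v = refl
  weight-++ ((m , t) ∷ ts) ss u v =
    trans (cong (_ +_) (weight-++ ts ss u v)) (sym (+-assoc _ (weight ts u v) (weight ss u v)))

  weight-scale : ∀ q ts u v → weight (scale q ts) u v ≡ q * weight ts u v
  weight-scale q []             u v = sym (*-zeroʳ q)
  weight-scale q ((m , t) ∷ ts) u v with covers? u v t
  ... | yes _ = trans (cong (q * m +_) (weight-scale q ts u v)) (sym (*-distribˡ-+ q m _))
  ... | no  _ = weight-scale q ts u v

  scale-distinct : ∀ q {ts} → AllDistinct ts → AllDistinct (scale q ts)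
  scale-distinct q []       = []
  scale-distinct q (d ∷ ds) = d ∷ scale-distinct q ds

  expand-distinct : ∀ {ts} → AllDistinct ts → ∀ {t} → t ∈ expand ts → Distinct t
  expand-distinct {(m , t) ∷ ts} (d ∷ ds) t∈ with ∈-++⁻ (replicate m t) t∈
  ... | inj₁ t∈rep = All.lookup (replicate⁺ m d) t∈rep
  ... | inj₂ t∈ts  = expand-distinct ds t∈ts

module _ {k n : ℕ} where

  lift : (Fin k → Fin n) → Triple k → Block k n
  lift f (a , b , c) = (a , f a) ∷ (b , f b) ∷ (c , f c) ∷ []

  lift-size : ∀ f {t} → Distinct t → IsSubsetOfSize 3 (lift f t)
  lift-size f (a≢b , a≢c , b≢c) =
    ((a≢b ∘ cong proj₁) ∷ (a≢c ∘ cong proj₁) ∷ []) ∷ ((b≢c ∘ cong proj₁) ∷ []) ∷ [] ∷ [] , refl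

  ∈-lift⁻ : ∀ f t {u x} → (u , x) ∈ lift f t → u ∈ᵗ t × f u ≡ x
  ∈-lift⁻ f t (here refl)                 = inj₁ refl , refl
  ∈-lift⁻ f t (there (here refl))         = inj₂ (inj₁ refl) , refl
  ∈-lift⁻ f t (there (there (here refl))) = inj₂ (inj₂ refl) , refl

  ∈-lift⁺ : ∀ f t {u} → u ∈ᵗ t → (u , f u) ∈ lift f t
  ∈-lift⁺ f t (inj₁ refl)        = here refl
  ∈-lift⁺ f t (inj₂ (inj₁ refl)) = there (here refl)
  ∈-lift⁺ f t (inj₂ (inj₂ refl)) = there (there (here refl))

  count-lift : ∀ f ts u v → count (pair∈? (u , f u) (v , f v)) (map (lift f) ts) ≡ count (covers? u v) ts
  count-lift f ts u v =
    trans (count-map (pair∈? (u , f u) (v , f v)) (lift f) ts)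
          (count-≐ _ (covers? u v)
            ((λ {t} (u∈ , v∈) → proj₁ (∈-lift⁻ f t u∈) , proj₁ (∈-lift⁻ f t v∈)) ,
             (λ {t} (u∈ , v∈) → ∈-lift⁺ f t u∈ , ∈-lift⁺ f t v∈)) ts)

  count-lift-miss : ∀ f ts {u x v y} → ¬ (f u ≡ x × f v ≡ y) →
                    count (pair∈? (u , x) (v , y)) (map (lift f) ts) ≡ 0
  count-lift-miss f ts {u} {x} {v} {y} miss =
    count-none (pair∈? (u , x) (v , y)) {map (lift f) ts} λ B∈ (x∈ , y∈) →
    let t , _ , B≡ = ∈-map⁻ (lift f) B∈ in
    miss (proj₂ (∈-lift⁻ f t (subst (_ ∈_) B≡ x∈)) , proj₂ (∈-lift⁻ f t (subst (_ ∈_) B≡ y∈)))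

-- From edge labellings to SBGDDs

SameEdge : ∀ {A : Set} → A × A → A × A → Set
SameEdge (u , v) (u′ , v′) = (u ≡ u′ × v ≡ v′) ⊎ (u ≡ v′ × v ≡ u′)

same-edge-join : ∀ {A : Set} {e x y : A × A} → SameEdge e x → SameEdge e y → SameEdge x y
same-edge-join (inj₁ (refl , refl)) (inj₁ (refl , refl)) = inj₁ (refl , refl)
same-edge-join (inj₁ (refl , refl)) (inj₂ (refl , refl)) = inj₂ (refl , refl)
same-edge-join (inj₂ (refl , refl)) (inj₁ (refl , refl)) = inj₂ (refl , refl)
same-edge-join (inj₂ (refl , refl)) (inj₂ (refl , refl)) = inj₁ (refl , refl)

-- label a b u v labels the edge {u , v} of the TD block through (g₀ , a) and (g₁ , b).
record EdgeLabelling (n k L : ℕ) (label : Fin n → Fin n → Fin k → Fin k → ℕ) : Set where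
  field
    injective : ∀ {a b u v a′ b′ u′ v′} → u ≢ v → u′ ≢ v′ → label a b u v ≡ label a′ b′ u′ v′ →
                a ≡ a′ × b ≡ b′ × SameEdge (u , v) (u′ , v′)
    bounded   : ∀ a b {u v} → u ≢ v → label a b u v < L
    onto      : ∀ {m} → m < L → ∃[ a ] ∃[ b ] ∃[ u ] ∃[ v ] u ≢ v × label a b u v ≡ m

relabel : ∀ {n k L f g} → EdgeLabelling n k L g → (∀ a b {u v} → u ≢ v → f a b u v ≡ g a b u v) →
          EdgeLabelling n k L f
relabel labelling f≡g = record
  { injective = λ u≢v u′≢v′ eq → injective u≢v u′≢v′ (trans (sym (f≡g _ _ u≢v)) (trans eq (f≡g _ _ u′≢v′)))
  ; bounded   = λ a b u≢v → subst (_< _) (sym (f≡g a b u≢v)) (bounded a b u≢v)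
  ; onto      = λ m<L → let a , b , u , v , u≢v , e = onto m<L in
                        a , b , u , v , u≢v , trans (f≡g a b u≢v) e
  }
  where open EdgeLabelling labelling

module Construction {k n : ℕ} (td : TD k n) (g₀ g₁ : Fin k) (g₀≢g₁ : g₀ ≢ g₁) where
  open Transversal td
  open Coordinates g₀ g₁ g₀≢g₁

  module Design (templates : Fin n → Fin n → Weighted k)
           (templates-distinct : ∀ a b → AllDistinct (templates a b))
           (extra : List (Block k n))
           (extra-size : ∀ {B} → B ∈ extra → IsSubsetOfSize 3 B)
           (extra-same : ∀ p q → p ≢ q → group p ≡ group q → freq extra p q ≡ 0)
           (extraWeight : Fin n → Fin n → Fin k → Fin k → ℕ)
           (extra-cross : ∀ a b {u v} → u ≢ v →
                          freq extra (u , point a b u) (v , point a b v) ≡ extraWeight a b u v)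
    where

    pairs : List (Fin n × Fin n)
    pairs = cartesianProduct (allFin n) (allFin n)

    blocksAt : Fin n × Fin n → List (Block k n)
    blocksAt (a , b) = map (lift (point a b)) (expand (templates a b))

    main : List (Block k n)
    main = concat (map blocksAt pairs)

    design : List (Block k n)
    design = main ++ extra

    frequency : Fin n → Fin n → Fin k → Fin k → ℕ
    frequency a b u v = weight (templates a b) u v + extraWeight a b u v

    ∈-main⁻ : ∀ {B} → B ∈ main → ∃[ a ] ∃[ b ] ∃[ t ] t ∈ expand (templates a b) × B ≡ lift (point a b) t
    ∈-main⁻ B∈ with _ , B∈bs , bs∈ ← ∈-concat⁻′ (map blocksAt pairs) B∈
               with (a , b) , _ , refl ← ∈-map⁻ blocksAt bs∈
               with t , t∈ , B≡ ← ∈-map⁻ (lift (point a b)) B∈bs = a , b , t , t∈ , B≡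

    count-main : ∀ a b {u v} → u ≢ v →
                 count (pair∈? (u , point a b u) (v , point a b v)) main ≡ weight (templates a b) u v
    count-main a b {u} {v} u≢v = begin
      count P? main                                 ≡⟨ count-concat P? (map blocksAt pairs) ⟩
      sum (map (count P?) (map blocksAt pairs))     ≡⟨ cong sum (sym (map-∘ pairs)) ⟩
      sum (map (count P? ∘ blocksAt) pairs)         ≡⟨ sum-map-single (count P? ∘ blocksAt)
                                                         (cartesianProduct⁺ (allFin⁺ n) (allFin⁺ n))
                                                         (∈-cartesianProduct⁺ (∈-allFin a) (∈-allFin b)) others ⟩
      count P? (blocksAt (a , b))                   ≡⟨ count-lift (point a b) (expand (templates a b)) u v ⟩
      count (covers? u v) (expand (templates a b))  ≡⟨ count-expand (templates a b) u v ⟩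
      weight (templates a b) u v                    ∎
      where
      open ≡-Reasoning
      P? = pair∈? (u , point a b u) (v , point a b v)
      others : ∀ {ab} → ab ∈ pairs → ab ≢ (a , b) → count P? (blocksAt ab) ≡ 0
      others {a′ , b′} _ ab≢ab = count-lift-miss (point a′ b′) (expand (templates a′ b′)) λ (eu , ev) →
        ab≢ab (let a′≡a , b′≡b = point-injective u≢v eu ev in cong₂ _,_ a′≡a b′≡b)

    freq-design : ∀ a b {u v} → u ≢ v →
                  freq design (u , point a b u) (v , point a b v) ≡ frequency a b u v
    freq-design a b {u} {v} u≢v =
      trans (count-++ (pair∈? (u , point a b u) (v , point a b v)) main extra)
            (cong₂ _+_ (count-main a b u≢v) (extra-cross a b u≢v))

    design-size : ∀ {B} → B ∈ design → IsSubsetOfSize 3 B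
    design-size B∈ with ∈-++⁻ main B∈
    ... | inj₂ B∈extra = extra-size B∈extra
    ... | inj₁ B∈main with a , b , t , t∈ , refl ← ∈-main⁻ B∈main =
      lift-size (point a b) (expand-distinct (templates-distinct a b) t∈)

    design-same : ∀ p q → p ≢ q → group p ≡ group q → freq design p q ≡ 0
    design-same (u , x) (.u , y) p≢q refl =
      trans (count-++ (pair∈? (u , x) (u , y)) main extra)
            (cong₂ _+_ (count-none (pair∈? (u , x) (u , y)) no-main) (extra-same (u , x) (u , y) p≢q refl))
      where
      no-main : ∀ {B} → B ∈ main → ¬ ((u , x) ∈ B × (u , y) ∈ B)
      no-main B∈ (x∈ , y∈) with a , b , t , _ , refl ← ∈-main⁻ B∈ =
        p≢q (cong (u ,_) (trans (sym (proj₂ (∈-lift⁻ (point a b) t x∈))) (proj₂ (∈-lift⁻ (point a b) t y∈))))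

    sbgdd : EdgeLabelling n k (n * n * (k C 2)) frequency → SBGDD 0 n k
    sbgdd labelling = record
      { blocks    = design
      ; blockSize = design-size
      ; sameGroup = design-same
      ; distinct  = distinct
      ; inRange   = λ p q gp≢gq → z≤n , bounded′ p q gp≢gq
      ; onto      = λ m _ m< → let a , b , u , v , u≢v , e = onto m< in
                      (u , point a b u) , (v , point a b v) , u≢v , trans (freq-design a b u≢v) e
      }
      where
      open EdgeLabelling labelling

      cross : ∀ {u v} x y → u ≢ v → ∃[ a ] ∃[ b ] point a b u ≡ x × point a b v ≡ y ×
              freq design (u , x) (v , y) ≡ frequency a b u v
      cross x y u≢v with a , b , refl , refl ← point-surjective u≢v x y = a , b , refl , refl , freq-design a b u≢v

      bounded′ : ∀ p q → group p ≢ group q → freq design p q < n * n * (k C 2)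
      bounded′ (u , x) (v , y) u≢v with a , b , _ , _ , f≡ ← cross x y u≢v = subst (_< _) (sym f≡) (bounded a b u≢v)

      distinct : ∀ p q p′ q′ → group p ≢ group q → group p′ ≢ group q′ →
                 freq design p q ≡ freq design p′ q′ → (p ≡ p′ × q ≡ q′) ⊎ (p ≡ q′ × q ≡ p′)
      distinct (u , x) (v , y) (u′ , x′) (v′ , y′) u≢v u′≢v′ eq
        with a , b , refl , refl , f≡ ← cross x y u≢v
           | a′ , b′ , refl , refl , f≡′ ← cross x′ y′ u′≢v′
        with refl , refl , same ← injective u≢v u′≢v′ (trans (sym f≡) (trans eq f≡′))
        with same
      ... | inj₁ (refl , refl) = inj₁ (refl , refl)
      ... | inj₂ (refl , refl) = inj₂ (refl , refl)

-- Periodic labellings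

module _ {d : ℕ} .{{_ : NonZero d}} where

  [r+q*d]%d≡r : ∀ {r} q → r < d → (r + q * d) % d ≡ r
  [r+q*d]%d≡r {r} q r<d = trans ([m+kn]%n≡m%n r q d) (m<n⇒m%n≡m r<d)

  [r+q*d]/d≡q : ∀ {r} q → r < d → (r + q * d) / d ≡ q
  [r+q*d]/d≡q {r} q r<d =
    trans (+-distrib-/-∣ʳ r (n∣m*n q)) (cong₂ _+_ (m<n⇒m/n≡0 r<d) (m*n/n≡m q d))

  divMod-unique : ∀ {r r′ q q′} → r < d → r′ < d → r + q * d ≡ r′ + q′ * d → r ≡ r′ × q ≡ q′
  divMod-unique {q = q} {q′} r<d r′<d eq =
    trans (sym ([r+q*d]%d≡r q r<d)) (trans (cong (_% d) eq) ([r+q*d]%d≡r q′ r′<d)) ,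
    trans (sym ([r+q*d]/d≡q q r<d)) (trans (cong (_/ d) eq) ([r+q*d]/d≡q q′ r′<d))

-- Indices j < N are split as j = r + q P, labels as t + q (P E).  All periods q < N / P are
-- complete; in the last one only the residues r < N % P occur, and these must carry exactly
-- the labels t < (N % P) E.
module LastPeriod (P E N : ℕ) .{{_ : NonZero P}} where

  private
    ρ = N % P
    Q = N / P

    N≡ : N ≡ ρ + Q * P
    N≡ = m≡m%n+[m/n]*n N P

    distrib : ∀ a b p c → (a + b * p) * c ≡ a * c + b * (p * c)
    distrib = solve-∀

    N*E≡ : N * E ≡ ρ * E + Q * (P * E)
    N*E≡ = trans (cong (_* E) N≡) (distrib ρ Q P E)

  open ≤-Reasoning

  label< : ∀ {r q t} → t < P * E → (r < N % P → t < N % P * E) → r + q * P < N → t + q * (P * E) < N * E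
  label< {r} {q} {t} t<S last j<N with <-cmp q Q
  ... | tri< q<Q _ _ = begin-strict
    t + q * (P * E)       <⟨ +-monoˡ-< (q * (P * E)) t<S ⟩
    suc q * (P * E)       ≤⟨ *-monoˡ-≤ (P * E) q<Q ⟩
    Q * (P * E)           ≤⟨ m≤n+m _ (ρ * E) ⟩
    ρ * E + Q * (P * E)   ≡⟨ sym N*E≡ ⟩
    N * E                 ∎
  ... | tri≈ _ refl _ = begin-strict
    t + Q * (P * E)       <⟨ +-monoˡ-< (Q * (P * E)) (last r<ρ) ⟩
    ρ * E + Q * (P * E)   ≡⟨ sym N*E≡ ⟩
    N * E                 ∎
    where
    r<ρ : r < ρ
    r<ρ = +-cancelʳ-< (Q * P) r ρ (<-≤-trans j<N (≤-reflexive N≡))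
  ... | tri> _ _ Q<q = ⊥-elim (<⇒≱ j<N (begin
    N                     ≡⟨ N≡ ⟩
    ρ + Q * P             ≤⟨ +-monoˡ-≤ (Q * P) (<⇒≤ (m%n<n N P)) ⟩
    suc Q * P             ≤⟨ *-monoˡ-≤ P Q<q ⟩
    q * P                 ≤⟨ m≤n+m (q * P) r ⟩
    r + q * P             ∎))

  index< : ∀ {r q t} → r < P → (t < N % P * E → r < N % P) → t + q * (P * E) < N * E → r + q * P < N
  index< {r} {q} {t} r<P last l<NE with <-cmp q Q
  ... | tri< q<Q _ _ = begin-strict
    r + q * P             <⟨ +-monoˡ-< (q * P) r<P ⟩
    suc q * P             ≤⟨ *-monoˡ-≤ P q<Q ⟩
    Q * P                 ≤⟨ m≤n+m _ ρ ⟩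
    ρ + Q * P             ≡⟨ sym N≡ ⟩
    N                     ∎
  ... | tri≈ _ refl _ = begin-strict
    r + Q * P             <⟨ +-monoˡ-< (Q * P) (last t<ρE) ⟩
    ρ + Q * P             ≡⟨ sym N≡ ⟩
    N                     ∎
    where
    t<ρE : t < ρ * E
    t<ρE = +-cancelʳ-< (Q * (P * E)) t (ρ * E) (<-≤-trans l<NE (≤-reflexive N*E≡))
  ... | tri> _ _ Q<q = ⊥-elim (<⇒≱ l<NE (begin
    N * E                 ≡⟨ N*E≡ ⟩
    ρ * E + Q * (P * E)   ≤⟨ +-monoˡ-≤ (Q * (P * E)) (*-monoˡ-≤ E (<⇒≤ (m%n<n N P))) ⟩
    suc Q * (P * E)       ≤⟨ *-monoˡ-≤ (P * E) Q<q ⟩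
    q * (P * E)           ≤⟨ m≤n+m _ t ⟩
    t + q * (P * E)       ∎))

-- residue s and edge s b invert the P tables, which together take every value below P E once.
blockIndex : ∀ {n} → Fin n → Fin n → ℕ
blockIndex a b = Fin.toℕ (Fin.combine a b)

module PeriodicLabelling {n k : ℕ} (P E : ℕ) .{{_ : NonZero P}} .{{_ : NonZero E}}
  (table   : ℕ → Fin n → Fin k → Fin k → ℕ)
  (residue : ℕ → ℕ)
  (edge    : ℕ → Fin n → Fin k × Fin k)
  (table<        : ∀ {r} b {u v} → r < P → u ≢ v → table r b u v < P * E)
  (residue-table : ∀ {r} b {u v} → r < P → u ≢ v → residue (table r b u v) ≡ r)
  (edge-table    : ∀ {r} b {u v} → r < P → u ≢ v → SameEdge (edge (table r b u v) b) (u , v))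
  (residue<      : ∀ {s} → s < P * E → residue s < P)
  (table-edge    : ∀ {s} b → s < P * E → proj₁ (edge s b) ≢ proj₂ (edge s b) ×
                                         table (residue s) b (proj₁ (edge s b)) (proj₂ (edge s b)) ≡ s)
  (last-table    : ∀ {r} b {u v} → r < n * n % P → u ≢ v → table r b u v < n * n % P * E)
  (last-residue  : ∀ {s} → s < n * n % P * E → residue s < n * n % P)
  where

  label : Fin n → Fin n → Fin k → Fin k → ℕ
  label a b u v = table (blockIndex a b % P) b u v + blockIndex a b / P * (P * E)

  private
    instance _ = m*n≢0 P E

    index-split : ∀ (a b : Fin n) → blockIndex a b ≡ blockIndex a b % P + blockIndex a b / P * P
    index-split a b = m≡m%n+[m/n]*n (blockIndex a b) P

    index%P< : ∀ (a b : Fin n) → blockIndex a b % P < P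
    index%P< a b = m%n<n (blockIndex a b) P

  labelling : EdgeLabelling n k (n * n * E) label
  labelling = record { injective = injective ; bounded = bounded ; onto = onto }
    where
    open LastPeriod P E (n * n)

    index≡ : ∀ {a b u v a′ b′ u′ v′} → u ≢ v → u′ ≢ v′ →
             table (blockIndex a b % P) b u v ≡ table (blockIndex a′ b′ % P) b′ u′ v′ →
             blockIndex a b / P ≡ blockIndex a′ b′ / P → blockIndex a b ≡ blockIndex a′ b′
    index≡ {a} {b} {u} {v} {a′} {b′} u≢v u′≢v′ t≡t′ q≡q′ = begin
      blockIndex a b                                  ≡⟨ index-split a b ⟩
      blockIndex a b % P + blockIndex a b / P * P     ≡⟨ cong₂ (λ r q → r + q * P) r≡r′ q≡q′ ⟩
      blockIndex a′ b′ % P + blockIndex a′ b′ / P * P ≡⟨ sym (index-split a′ b′) ⟩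
      blockIndex a′ b′                                ∎
      where
      open ≡-Reasoning
      r≡r′ = trans (sym (residue-table b (index%P< a b) u≢v))
                   (trans (cong residue t≡t′) (residue-table b′ (index%P< a′ b′) u′≢v′))

    injective : ∀ {a b u v a′ b′ u′ v′} → u ≢ v → u′ ≢ v′ → label a b u v ≡ label a′ b′ u′ v′ →
                a ≡ a′ × b ≡ b′ × SameEdge (u , v) (u′ , v′)
    injective {a} {b} {u} {v} {a′} {b′} {u′} {v′} u≢v u′≢v′ eq
      with t≡t′ , q≡q′ ← divMod-unique (table< b (index%P< a b) u≢v) (table< b′ (index%P< a′ b′) u′≢v′) eq
      with refl , refl ← combine-injective a b a′ b′ (toℕ-injective (index≡ u≢v u′≢v′ t≡t′ q≡q′)) =
      refl , refl , same-edge-join (edge-table b (index%P< a b) u≢v)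
                      (subst (λ t → SameEdge (edge t b) (u′ , v′)) (sym t≡t′) (edge-table b (index%P< a b) u′≢v′))

    bounded : ∀ a b {u v} → u ≢ v → label a b u v < n * n * E
    bounded a b u≢v = label< {q = blockIndex a b / P} (table< b (index%P< a b) u≢v)
                             (λ r<ρ → last-table b r<ρ u≢v)
                             (subst (_< n * n) (index-split a b) (toℕ<n (Fin.combine a b)))

    onto : ∀ {m} → m < n * n * E → ∃[ a ] ∃[ b ] ∃[ u ] ∃[ v ] u ≢ v × label a b u v ≡ m
    onto {m} m<L = a , b , proj₁ (edge s b) , proj₂ (edge s b) , proj₁ (table-edge b s<S) , label≡m
      where
      s = m % (P * E)
      q = m / (P * E)
      s<S = m%n<n m (P * E)
      m≡ : m ≡ s + q * (P * E)
      m≡ = m≡m%n+[m/n]*n m (P * E)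
      r<P = residue< s<S
      j<N : residue s + q * P < n * n
      j<N = index< {q = q} r<P last-residue (subst (_< n * n * E) m≡ m<L)
      ab = Fin.remQuot {n} n (Fin.fromℕ< j<N)
      a = proj₁ ab
      b = proj₂ ab
      index-ab≡ : blockIndex a b ≡ residue s + q * P
      index-ab≡ = trans (cong Fin.toℕ (combine-remQuot {n} n (Fin.fromℕ< j<N))) (toℕ-fromℕ< j<N)
      label≡m : label a b (proj₁ (edge s b)) (proj₂ (edge s b)) ≡ m
      label≡m = begin
        label a b (proj₁ (edge s b)) (proj₂ (edge s b))
          ≡⟨ cong₂ (λ r q → table r b (proj₁ (edge s b)) (proj₂ (edge s b)) + q * (P * E))
                   (trans (cong (_% P) index-ab≡) ([r+q*d]%d≡r q r<P))
                   (trans (cong (_/ P) index-ab≡) ([r+q*d]/d≡q q r<P)) ⟩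
        table (residue s) b (proj₁ (edge s b)) (proj₂ (edge s b)) + q * (P * E)
          ≡⟨ cong (_+ q * (P * E)) (proj₂ (table-edge b s<S)) ⟩
        s + q * (P * E)
          ≡⟨ sym m≡ ⟩
        m ∎
        where open ≡-Reasoning

-- k = 5, 6, 8

below : ∀ {P} {Q : ℕ → Set} → (∀ (r : Fin P) → Q (Fin.toℕ r)) → ∀ {r} → r < P → Q r
below {Q = Q} h r<P = subst Q (toℕ-fromℕ< r<P) (h (Fin.fromℕ< r<P))

square-residue : ∀ m .{{_ : NonZero m}} → (∀ (t : Fin m) → Fin.toℕ t * Fin.toℕ t % m ≤ 1) →
                 ∀ n → n * n % m ≤ 1
square-residue m small n =
  subst (_≤ 1) (sym (%-distribˡ-* n n m)) (below {Q = λ t → t * t % m ≤ 1} small (m%n<n n m))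

module _ {k : ℕ} where

  increasing? : Decidable (λ ((a , b , c) : Triple k) → a Fin.< b × b Fin.< c)
  increasing? (a , b , c) = (a Fin.<? b) ×-dec (b Fin.<? c)

  -- every 3-subset of {0, …, k - 1} with multiplicity m; each edge then has weight (k - 2) m
  uniform : ℕ → Weighted k
  uniform m = map (m ,_) (filter increasing? (cartesianProduct (allFin k)
                                               (cartesianProduct (allFin k) (allFin k))))

  same-edge? : (e e′ : Fin k × Fin k) → Dec (SameEdge e e′)
  same-edge? (u , v) (u′ , v′) = ((u Fin.≟ u′) ×-dec (v Fin.≟ v′)) ⊎-dec ((u Fin.≟ v′) ×-dec (v Fin.≟ u′))

-- The block with index j = r + q P receives base r and q copies of uniform copies, whose edge
-- weights are all P C(k,2).  Entry s of inverse is the residue and the edge carrying label s.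
record PeriodicData (k P : ℕ) : Set where
  field
    base    : ℕ → Weighted k
    copies  : ℕ
    inverse : List (ℕ × Fin k × Fin k)

module _ {k P : ℕ} (D : PeriodicData k P) where
  open PeriodicData D

  table : ℕ → Fin k → Fin k → ℕ
  table r = weight (base r)

  -- junk value (0 , d , d) beyond the end of inverse
  entry : Fin k → ℕ → ℕ × Fin k × Fin k
  entry d s = fromMaybe (0 , d , d) (head (drop s inverse))

  -- Quantified over Fin so that they can be decided by evaluation.  The last two fields say that
  -- residue 0 carries exactly the labels below C(k,2), as LastPeriod needs when n² ≡ 1 (mod P).
  record Valid (d : Fin k) : Set where
    field
      base-distinct    : ∀ (r : Fin P) → AllDistinct (base (Fin.toℕ r))
      uniform-distinct : AllDistinct (uniform {k} copies)
      uniform-weight   : ∀ u v → u ≢ v → weight (uniform {k} copies) u v ≡ P * (k C 2)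
      table-entry      : ∀ (r : Fin P) u v → u ≢ v →
                         table (Fin.toℕ r) u v < P * (k C 2) ×
                         proj₁ (entry d (table (Fin.toℕ r) u v)) ≡ Fin.toℕ r ×
                         SameEdge (proj₂ (entry d (table (Fin.toℕ r) u v))) (u , v)
      entry-table      : ∀ (s : Fin (P * (k C 2))) → let r , u , v = entry d (Fin.toℕ s) in
                         r < P × u ≢ v × table r u v ≡ Fin.toℕ s
      first-table      : ∀ u v → u ≢ v → table 0 u v < k C 2
      first-entry      : ∀ (s : Fin (k C 2)) → proj₁ (entry d (Fin.toℕ s)) ≡ 0

  valid? : ∀ d → Dec (Valid d)
  valid? d = map′ (λ (h₁ , h₂ , h₃ , h₄ , h₅ , h₆ , h₇) → record
                     { base-distinct = h₁ ; uniform-distinct = h₂ ; uniform-weight = h₃ ; table-entry = h₄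
                     ; entry-table = h₅ ; first-table = h₆ ; first-entry = h₇ })
                  (λ v → let open Valid v in
                     base-distinct , uniform-distinct , uniform-weight , table-entry , entry-table ,
                     first-table , first-entry)
    (all? (λ r → All.all? (distinct? ∘ proj₂) (base (Fin.toℕ r))) ×-dec
     All.all? (distinct? ∘ proj₂) (uniform {k} copies) ×-dec
     all? (λ u → all? λ v → ¬? (u Fin.≟ v) →-dec (weight (uniform {k} copies) u v ℕ.≟ P * (k C 2))) ×-dec
     all? (λ r → all? λ u → all? λ v → ¬? (u Fin.≟ v) →-dec
       ((table (Fin.toℕ r) u v <? P * (k C 2)) ×-dec
        (proj₁ (entry d (table (Fin.toℕ r) u v)) ℕ.≟ Fin.toℕ r) ×-dec
        same-edge? (proj₂ (entry d (table (Fin.toℕ r) u v))) (u , v))) ×-dec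
     all? (λ s → let r , u , v = entry d (Fin.toℕ s) in
       (r <? P) ×-dec ¬? (u Fin.≟ v) ×-dec (table r u v ℕ.≟ Fin.toℕ s)) ×-dec
     all? (λ u → all? λ v → ¬? (u Fin.≟ v) →-dec (table 0 u v <? k C 2)) ×-dec
     all? (λ s → proj₁ (entry d (Fin.toℕ s)) ℕ.≟ 0))

module _ {k P : ℕ} .{{_ : NonZero P}} .{{_ : NonZero (k C 2)}} (D : PeriodicData k P)
         {g₀ g₁ : Fin k} (g₀≢g₁ : g₀ ≢ g₁) (valid : Valid D g₀) where
  open PeriodicData D
  open Valid valid

  private
    E = k C 2

    residue : ℕ → ℕ
    residue s = proj₁ (entry D g₀ s)

    edge : ℕ → Fin k × Fin k
    edge s = proj₂ (entry D g₀ s)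

    TableEntry : Fin k → Fin k → ℕ → Set
    TableEntry u v r = table D r u v < P * E × residue (table D r u v) ≡ r × SameEdge (edge (table D r u v)) (u , v)

    EntryTable : ℕ → Set
    EntryTable s = residue s < P × proj₁ (edge s) ≢ proj₂ (edge s) ×
                   table D (residue s) (proj₁ (edge s)) (proj₂ (edge s)) ≡ s

    table-entry′ : ∀ {r u v} → r < P → u ≢ v → TableEntry u v r
    table-entry′ {u = u} {v} r<P u≢v = below {Q = TableEntry u v} (λ r → table-entry r u v u≢v) r<P

    entry-table′ : ∀ {s} → s < P * E → EntryTable s
    entry-table′ = below {Q = EntryTable} entry-table

    last-table : ∀ {ρ r u v} → ρ ≤ 1 → r < ρ → u ≢ v → table D r u v < ρ * E
    last-table {u = u} {v} (s≤s z≤n) (s≤s z≤n) u≢v =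
      subst (table D 0 u v <_) (sym (*-identityˡ E)) (first-table u v u≢v)

    last-residue : ∀ {ρ s} → ρ ≤ 1 → s < ρ * E → residue s < ρ
    last-residue {s = s} (s≤s z≤n) s<E =
      subst (_< 1) (sym (below {Q = λ s → residue s ≡ 0} first-entry (subst (s <_) (*-identityˡ E) s<E))) (s≤s z≤n)

  periodic-sbgdd : ∀ {n} → n * n % P ≤ 1 → TD k n → SBGDD 0 n k
  periodic-sbgdd {n} ρ≤1 td = sbgdd (relabel labelling frequency≡label)
    where
    templates : Fin n → Fin n → Weighted k
    templates a b = base (blockIndex a b % P) ++ scale (blockIndex a b / P) (uniform copies)

    templates-distinct : ∀ a b → AllDistinct (templates a b)
    templates-distinct a b =
      ++⁺ (below {Q = AllDistinct ∘ base} base-distinct (m%n<n (blockIndex a b) P))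
          (scale-distinct (blockIndex a b / P) uniform-distinct)

    open Construction.Design td g₀ g₁ g₀≢g₁ templates templates-distinct
           [] (λ ()) (λ _ _ _ _ → refl) (λ _ _ _ _ → 0) (λ _ _ _ → refl)
    open PeriodicLabelling {n} {k} P E (λ r _ → table D r) residue (λ s _ → edge s)
           (λ _ r<P u≢v → proj₁ (table-entry′ r<P u≢v))
           (λ _ r<P u≢v → proj₁ (proj₂ (table-entry′ r<P u≢v)))
           (λ _ r<P u≢v → proj₂ (proj₂ (table-entry′ r<P u≢v)))
           (proj₁ ∘ entry-table′)
           (λ _ → proj₂ ∘ entry-table′)
           (λ _ → last-table ρ≤1)
           (last-residue ρ≤1)

    frequency≡label : ∀ a b {u v} → u ≢ v → frequency a b u v ≡ label a b u v
    frequency≡label a b {u} {v} u≢v = begin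
      weight (templates a b) u v + 0                   ≡⟨ +-identityʳ _ ⟩
      weight (templates a b) u v                       ≡⟨ weight-++ (base r) _ u v ⟩
      table D r u v + weight (scale q (uniform copies)) u v
                                                       ≡⟨ cong (table D r u v +_) (weight-scale q (uniform copies) u v) ⟩
      table D r u v + q * weight (uniform copies) u v  ≡⟨ cong (λ w → table D r u v + q * w) (uniform-weight u v u≢v) ⟩
      table D r u v + q * (P * E)                      ∎
      where
      open ≡-Reasoning
      r = blockIndex a b % P
      q = blockIndex a b / P

design₅ : PeriodicData 5 3
design₅ = record { base = base ; copies = 10 ; inverse = inverse }
  where
  base : ℕ → Weighted 5
  base 0 = (2 , (# 0 , # 1 , # 2)) ∷ (7 , (# 0 , # 1 , # 3)) ∷ (4 , (# 0 , # 2 , # 4)) ∷ (1 , (# 1 , # 2 , # 3)) ∷ (1 , (# 2 , # 3 , # 4)) ∷ []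
  base 1 = (6 , (# 0 , # 1 , # 2)) ∷ (8 , (# 0 , # 1 , # 3)) ∷ (5 , (# 0 , # 2 , # 3)) ∷ (7 , (# 0 , # 2 , # 4)) ∷ (8 , (# 0 , # 3 , # 4)) ∷ (5 , (# 1 , # 2 , # 3)) ∷ (8 , (# 1 , # 2 , # 4)) ∷ (4 , (# 1 , # 3 , # 4)) ∷ (1 , (# 2 , # 3 , # 4)) ∷ []
  base 2 = (1 , (# 0 , # 1 , # 2)) ∷ (8 , (# 0 , # 1 , # 3)) ∷ (11 , (# 0 , # 1 , # 4)) ∷ (8 , (# 0 , # 2 , # 3)) ∷ (1 , (# 0 , # 2 , # 4)) ∷ (11 , (# 0 , # 3 , # 4)) ∷ (11 , (# 1 , # 2 , # 3)) ∷ (12 , (# 1 , # 2 , # 4)) ∷ (6 , (# 1 , # 3 , # 4)) ∷ (9 , (# 2 , # 3 , # 4)) ∷ []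
  base _ = []
  inverse : List (ℕ × Fin 5 × Fin 5)
  inverse = (0 , # 1 , # 4) ∷ (0 , # 3 , # 4) ∷ (0 , # 2 , # 3) ∷ (0 , # 1 , # 2) ∷ (0 , # 0 , # 4) ∷ (0 , # 2 , # 4) ∷ (0 , # 0 , # 2) ∷ (0 , # 0 , # 3) ∷ (0 , # 1 , # 3) ∷ (0 , # 0 , # 1) ∷ (2 , # 0 , # 2) ∷ (1 , # 2 , # 3) ∷ (1 , # 1 , # 4) ∷ (1 , # 3 , # 4) ∷ (1 , # 0 , # 1) ∷ (1 , # 0 , # 4) ∷ (1 , # 2 , # 4) ∷ (1 , # 1 , # 3) ∷ (1 , # 0 , # 2) ∷ (1 , # 1 , # 2) ∷ (2 , # 0 , # 1) ∷ (1 , # 0 , # 3) ∷ (2 , # 2 , # 4) ∷ (2 , # 0 , # 4) ∷ (2 , # 1 , # 2) ∷ (2 , # 1 , # 3) ∷ (2 , # 3 , # 4) ∷ (2 , # 0 , # 3) ∷ (2 , # 2 , # 3) ∷ (2 , # 1 , # 4) ∷ []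

design₆ : PeriodicData 6 4
design₆ = record { base = base ; copies = 15 ; inverse = inverse }
  where
  base : ℕ → Weighted 6
  base 0 = (1 , (# 0 , # 1 , # 3)) ∷ (4 , (# 0 , # 1 , # 5)) ∷ (9 , (# 0 , # 2 , # 3)) ∷ (2 , (# 0 , # 2 , # 4)) ∷ (4 , (# 0 , # 3 , # 5)) ∷ (1 , (# 1 , # 3 , # 4)) ∷ (2 , (# 1 , # 3 , # 5)) ∷ (2 , (# 2 , # 3 , # 4)) ∷ (1 , (# 2 , # 3 , # 5)) ∷ (9 , (# 2 , # 4 , # 5)) ∷ []
  base 1 = (10 , (# 0 , # 1 , # 3)) ∷ (5 , (# 0 , # 1 , # 4)) ∷ (12 , (# 0 , # 1 , # 5)) ∷ (8 , (# 0 , # 2 , # 3)) ∷ (12 , (# 0 , # 2 , # 4)) ∷ (3 , (# 0 , # 2 , # 5)) ∷ (8 , (# 0 , # 3 , # 4)) ∷ (2 , (# 0 , # 3 , # 5)) ∷ (10 , (# 1 , # 2 , # 3)) ∷ (5 , (# 1 , # 2 , # 4)) ∷ (6 , (# 1 , # 2 , # 5)) ∷ (5 , (# 1 , # 3 , # 4)) ∷ (4 , (# 1 , # 3 , # 5)) ∷ (4 , (# 1 , # 4 , # 5)) ∷ (1 , (# 2 , # 3 , # 4)) ∷ (1 , (# 2 , # 3 , # 5)) ∷ (6 , (# 2 , # 4 , # 5)) ∷ (8 , (# 3 , # 4 , # 5)) ∷ []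
  base 2 = (1 , (# 0 , # 1 , # 2)) ∷ (7 , (# 0 , # 1 , # 3)) ∷ (18 , (# 0 , # 1 , # 4)) ∷ (18 , (# 0 , # 1 , # 5)) ∷ (17 , (# 0 , # 2 , # 3)) ∷ (7 , (# 0 , # 2 , # 4)) ∷ (6 , (# 0 , # 2 , # 5)) ∷ (3 , (# 0 , # 3 , # 4)) ∷ (12 , (# 0 , # 3 , # 5)) ∷ (7 , (# 0 , # 4 , # 5)) ∷ (15 , (# 1 , # 2 , # 3)) ∷ (4 , (# 1 , # 2 , # 4)) ∷ (13 , (# 1 , # 2 , # 5)) ∷ (10 , (# 1 , # 3 , # 4)) ∷ (5 , (# 1 , # 3 , # 5)) ∷ (2 , (# 1 , # 4 , # 5)) ∷ (3 , (# 2 , # 3 , # 4)) ∷ (5 , (# 2 , # 3 , # 5)) ∷ (18 , (# 2 , # 4 , # 5)) ∷ (14 , (# 3 , # 4 , # 5)) ∷ []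
  base 3 = (17 , (# 0 , # 1 , # 2)) ∷ (4 , (# 0 , # 1 , # 3)) ∷ (12 , (# 0 , # 1 , # 4)) ∷ (13 , (# 0 , # 1 , # 5)) ∷ (20 , (# 0 , # 2 , # 3)) ∷ (8 , (# 0 , # 2 , # 4)) ∷ (10 , (# 0 , # 3 , # 4)) ∷ (14 , (# 0 , # 3 , # 5)) ∷ (25 , (# 0 , # 4 , # 5)) ∷ (15 , (# 1 , # 2 , # 4)) ∷ (17 , (# 1 , # 2 , # 5)) ∷ (24 , (# 1 , # 3 , # 4)) ∷ (23 , (# 1 , # 3 , # 5)) ∷ (3 , (# 1 , # 4 , # 5)) ∷ (17 , (# 2 , # 3 , # 4)) ∷ (13 , (# 2 , # 3 , # 5)) ∷ (17 , (# 2 , # 4 , # 5)) ∷ (8 , (# 3 , # 4 , # 5)) ∷ []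
  base _ = []
  inverse : List (ℕ × Fin 6 × Fin 6)
  inverse = (0 , # 1 , # 2) ∷ (0 , # 1 , # 4) ∷ (0 , # 0 , # 4) ∷ (0 , # 3 , # 4) ∷ (0 , # 1 , # 3) ∷ (0 , # 0 , # 1) ∷ (0 , # 1 , # 5) ∷ (0 , # 3 , # 5) ∷ (0 , # 0 , # 5) ∷ (0 , # 4 , # 5) ∷ (0 , # 2 , # 5) ∷ (0 , # 0 , # 2) ∷ (0 , # 2 , # 3) ∷ (0 , # 2 , # 4) ∷ (0 , # 0 , # 3) ∷ (1 , # 3 , # 5) ∷ (1 , # 2 , # 5) ∷ (1 , # 0 , # 5) ∷ (1 , # 4 , # 5) ∷ (1 , # 1 , # 4) ∷ (1 , # 2 , # 3) ∷ (1 , # 1 , # 2) ∷ (1 , # 3 , # 4) ∷ (1 , # 0 , # 2) ∷ (1 , # 2 , # 4) ∷ (1 , # 0 , # 4) ∷ (1 , # 1 , # 5) ∷ (1 , # 0 , # 1) ∷ (1 , # 0 , # 3) ∷ (1 , # 1 , # 3) ∷ (2 , # 3 , # 4) ∷ (2 , # 0 , # 2) ∷ (2 , # 2 , # 4) ∷ (2 , # 1 , # 2) ∷ (2 , # 1 , # 4) ∷ (2 , # 0 , # 4) ∷ (2 , # 3 , # 5) ∷ (2 , # 1 , # 3) ∷ (2 , # 1 , # 5) ∷ (2 , # 0 , # 3) ∷ (2 , # 2 , # 3) ∷ (2 , # 4 , # 5) ∷ (2 , # 2 , # 5) ∷ (2 , # 0 , # 5) ∷ (2 , # 0 , # 1)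 ∷ (3 , # 0 , # 2) ∷ (3 , # 0 , # 1) ∷ (3 , # 2 , # 5) ∷ (3 , # 0 , # 3) ∷ (3 , # 1 , # 2) ∷ (3 , # 2 , # 3) ∷ (3 , # 1 , # 3) ∷ (3 , # 0 , # 5) ∷ (3 , # 4 , # 5) ∷ (3 , # 1 , # 4) ∷ (3 , # 0 , # 4) ∷ (3 , # 1 , # 5) ∷ (3 , # 2 , # 4) ∷ (3 , # 3 , # 5) ∷ (3 , # 3 , # 4) ∷ []

design₈ : PeriodicData 8 3
design₈ = record { base = base ; copies = 14 ; inverse = inverse }
  where
  base : ℕ → Weighted 8
  base 0 = (1 , (# 0 , # 1 , # 4)) ∷ (1 , (# 0 , # 1 , # 5)) ∷ (3 , (# 0 , # 2 , # 4)) ∷ (2 , (# 0 , # 2 , # 5)) ∷ (3 , (# 0 , # 2 , # 7)) ∷ (1 , (# 0 , # 3 , # 4)) ∷ (7 , (# 0 , # 3 , # 5)) ∷ (1 , (# 0 , # 3 , # 6)) ∷ (3 , (# 0 , # 3 , # 7)) ∷ (5 , (# 0 , # 4 , # 7)) ∷ (1 , (# 0 , # 5 , # 6)) ∷ (6 , (# 0 , # 5 , # 7)) ∷ (7 , (# 0 , # 6 , # 7)) ∷ (6 , (# 1 , # 2 , # 6)) ∷ (1 , (# 1 , # 2 , # 7)) ∷ (3 , (# 1 , # 4 , # 6)) ∷ (4 , (# 1 , # 6 , # 7)) ∷ (2 , (# 2 , # 3 , # 6)) ∷ (1 , (# 2 , # 3 , # 7)) ∷ (10 , (# 2 , # 4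 , # 5)) ∷ (10 , (# 2 , # 4 , # 6)) ∷ (6 , (# 2 , # 5 , # 6)) ∷ (4 , (# 2 , # 5 , # 7)) ∷ (2 , (# 2 , # 6 , # 7)) ∷ (1 , (# 3 , # 4 , # 5)) ∷ (2 , (# 3 , # 4 , # 6)) ∷ (2 , (# 3 , # 4 , # 7)) ∷ (8 , (# 3 , # 5 , # 6)) ∷ (2 , (# 3 , # 5 , # 7)) ∷ (6 , (# 3 , # 6 , # 7)) ∷ (14 , (# 4 , # 5 , # 7)) ∷ (1 , (# 5 , # 6 , # 7)) ∷ []
  base 1 = (7 , (# 0 , # 1 , # 2)) ∷ (12 , (# 0 , # 1 , # 3)) ∷ (1 , (# 0 , # 1 , # 4)) ∷ (18 , (# 0 , # 1 , # 5)) ∷ (2 , (# 0 , # 1 , # 6)) ∷ (9 , (# 0 , # 1 , # 7)) ∷ (8 , (# 0 , # 2 , # 3)) ∷ (1 , (# 0 , # 2 , # 4)) ∷ (9 , (# 0 , # 2 , # 5)) ∷ (12 , (# 0 , # 2 , # 7)) ∷ (22 , (# 0 , # 3 , # 4)) ∷ (5 , (# 0 , # 3 , # 5)) ∷ (5 , (# 0 , # 3 , # 6)) ∷ (2 , (# 0 , # 3 , # 7)) ∷ (17 , (# 0 , # 4 , # 6)) ∷ (14 , (# 0 , # 4 , # 7)) ∷ (2 , (# 0 , # 5 , # 6)) ∷ (10 , (# 0 , # 5 , # 7)) ∷ (6 , (# 0 , # 6 , # 7)) ∷ (9 , (# 1 , # 2 , # 3)) ∷ (8 , (# 1 , # 2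 , # 4)) ∷ (5 , (# 1 , # 2 , # 5)) ∷ (18 , (# 1 , # 2 , # 6)) ∷ (5 , (# 1 , # 2 , # 7)) ∷ (3 , (# 1 , # 3 , # 4)) ∷ (4 , (# 1 , # 3 , # 5)) ∷ (6 , (# 1 , # 3 , # 7)) ∷ (2 , (# 1 , # 4 , # 5)) ∷ (9 , (# 1 , # 4 , # 6)) ∷ (12 , (# 1 , # 4 , # 7)) ∷ (2 , (# 1 , # 5 , # 6)) ∷ (8 , (# 1 , # 5 , # 7)) ∷ (5 , (# 1 , # 6 , # 7)) ∷ (5 , (# 2 , # 3 , # 4)) ∷ (2 , (# 2 , # 3 , # 5)) ∷ (4 , (# 2 , # 3 , # 6)) ∷ (5 , (# 2 , # 3 , # 7)) ∷ (20 , (# 2 , # 4 , # 5)) ∷ (10 , (# 2 , # 4 , # 6)) ∷ (3 , (# 2 , # 4 , # 7)) ∷ (1 , (# 2 , # 5 , # 6)) ∷ (1 , (# 2 , # 5 , # 7)) ∷ (17 , (# 2 , # 6 , # 7)) ∷ (9 , (# 3 , # 4 , # 5)) ∷ (3 , (# 3 , # 4 , # 6)) ∷ (11 , (# 3 , # 5 , # 6)) ∷ (26 , (# 3 , # 5 , # 7)) ∷ (7 , (# 3 , # 6 , # 7)) ∷ (8 , (# 4 , # 5 , # 6)) ∷ (1 , (# 4 , # 5 , # 7)) ∷ (1 , (# 4 , # 6 , # 7)) ∷ (5 , (# 5 , # 6 , # 7)) ∷ []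
  base 2 = (14 , (# 0 , # 1 , # 2)) ∷ (14 , (# 0 , # 1 , # 3)) ∷ (1 , (# 0 , # 1 , # 4)) ∷ (14 , (# 0 , # 1 , # 5)) ∷ (2 , (# 0 , # 1 , # 6)) ∷ (20 , (# 0 , # 1 , # 7)) ∷ (6 , (# 0 , # 2 , # 3)) ∷ (5 , (# 0 , # 2 , # 4)) ∷ (8 , (# 0 , # 2 , # 5)) ∷ (16 , (# 0 , # 2 , # 6)) ∷ (11 , (# 0 , # 2 , # 7)) ∷ (17 , (# 0 , # 3 , # 4)) ∷ (10 , (# 0 , # 3 , # 5)) ∷ (14 , (# 0 , # 3 , # 6)) ∷ (3 , (# 0 , # 3 , # 7)) ∷ (4 , (# 0 , # 4 , # 6)) ∷ (1 , (# 0 , # 4 , # 7)) ∷ (12 , (# 0 , # 5 , # 6)) ∷ (23 , (# 0 , # 5 , # 7)) ∷ (11 , (# 0 , # 6 , # 7)) ∷ (24 , (# 1 , # 2 , # 3)) ∷ (18 , (# 1 , # 2 , # 4)) ∷ (9 , (# 1 , # 2 , # 5)) ∷ (1 , (# 1 , # 2 , # 6)) ∷ (11 , (# 1 , # 2 , # 7)) ∷ (6 , (# 1 , # 3 , # 4)) ∷ (3 , (# 1 , # 3 , # 5)) ∷ (4 , (# 1 , # 3 , # 6)) ∷ (24 , (# 1 , # 3 , # 7)) ∷ (26 , (# 1 , # 4 , # 5)) ∷ (27 , (# 1 , # 4 , # 6)) ∷ (1 , (# 1 , # 4 , # 7)) ∷ (22 , (# 1 , # 5 , # 6)) ∷ (6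 , (# 1 , # 5 , # 7)) ∷ (10 , (# 1 , # 6 , # 7)) ∷ (14 , (# 2 , # 3 , # 5)) ∷ (26 , (# 2 , # 3 , # 6)) ∷ (14 , (# 2 , # 4 , # 5)) ∷ (10 , (# 2 , # 4 , # 6)) ∷ (31 , (# 2 , # 4 , # 7)) ∷ (5 , (# 2 , # 5 , # 6)) ∷ (13 , (# 2 , # 5 , # 7)) ∷ (16 , (# 2 , # 6 , # 7)) ∷ (29 , (# 3 , # 4 , # 5)) ∷ (19 , (# 3 , # 4 , # 6)) ∷ (12 , (# 3 , # 4 , # 7)) ∷ (8 , (# 3 , # 5 , # 6)) ∷ (17 , (# 3 , # 5 , # 7)) ∷ (2 , (# 3 , # 6 , # 7)) ∷ (1 , (# 4 , # 5 , # 6)) ∷ (1 , (# 4 , # 5 , # 7)) ∷ (15 , (# 4 , # 6 , # 7)) ∷ (8 , (# 5 , # 6 , # 7)) ∷ []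
  base _ = []
  inverse : List (ℕ × Fin 8 × Fin 8)
  inverse = (0 , # 1 , # 3) ∷ (0 , # 1 , # 5) ∷ (0 , # 0 , # 1) ∷ (0 , # 2 , # 3) ∷ (0 , # 1 , # 4) ∷ (0 , # 1 , # 7) ∷ (0 , # 3 , # 4) ∷ (0 , # 1 , # 2) ∷ (0 , # 0 , # 2) ∷ (0 , # 0 , # 6) ∷ (0 , # 0 , # 4) ∷ (0 , # 2 , # 7) ∷ (0 , # 0 , # 3) ∷ (0 , # 1 , # 6) ∷ (0 , # 3 , # 7) ∷ (0 , # 4 , # 6) ∷ (0 , # 5 , # 6) ∷ (0 , # 0 , # 5) ∷ (0 , # 3 , # 5) ∷ (0 , # 3 , # 6) ∷ (0 , # 6 , # 7) ∷ (0 , # 4 , # 7) ∷ (0 , # 2 , # 5) ∷ (0 , # 2 , # 4) ∷ (0 , # 0 , # 7) ∷ (0 , # 4 , # 5) ∷ (0 , # 2 , # 6) ∷ (0 , # 5 , # 7) ∷ (2 , # 0 , # 4) ∷ (1 , # 5 , # 6) ∷ (1 , # 3 , # 6) ∷ (1 , # 4 , # 7) ∷ (1 , # 0 , # 6) ∷ (1 , # 2 , # 3) ∷ (1 , # 1 , # 3) ∷ (1 , # 1 , # 4) ∷ (1 , # 1 , # 6) ∷ (1 , # 0 , # 2) ∷ (1 , # 2 , # 5) ∷ (1 , # 1 , # 5) ∷ (1 , # 4 , # 5) ∷ (1 , # 6 , # 7) ∷ (1 , # 3 , # 4) ∷ (1 , # 2 , # 7) ∷ (1 , # 0 , # 5)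 ∷ (1 , # 1 , # 7) ∷ (1 , # 3 , # 7) ∷ (1 , # 2 , # 4) ∷ (1 , # 4 , # 6) ∷ (1 , # 0 , # 1) ∷ (1 , # 2 , # 6) ∷ (1 , # 5 , # 7) ∷ (1 , # 1 , # 2) ∷ (1 , # 0 , # 7) ∷ (1 , # 0 , # 3) ∷ (1 , # 0 , # 4) ∷ (2 , # 5 , # 6) ∷ (1 , # 3 , # 5) ∷ (2 , # 3 , # 7) ∷ (2 , # 0 , # 6) ∷ (2 , # 0 , # 2) ∷ (2 , # 4 , # 7) ∷ (2 , # 6 , # 7) ∷ (2 , # 2 , # 5) ∷ (2 , # 0 , # 3) ∷ (2 , # 0 , # 1) ∷ (2 , # 1 , # 6) ∷ (2 , # 0 , # 5) ∷ (2 , # 5 , # 7) ∷ (2 , # 0 , # 7) ∷ (2 , # 2 , # 3) ∷ (2 , # 4 , # 5) ∷ (2 , # 1 , # 7) ∷ (2 , # 3 , # 6) ∷ (2 , # 2 , # 6) ∷ (2 , # 1 , # 3) ∷ (2 , # 4 , # 6) ∷ (2 , # 1 , # 2) ∷ (2 , # 2 , # 4) ∷ (2 , # 1 , # 4) ∷ (2 , # 1 , # 5) ∷ (2 , # 3 , # 5) ∷ (2 , # 2 , # 7) ∷ (2 , # 3 , # 4) ∷ []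

squares-mod-3 : ∀ n → n * n % 3 ≤ 1
squares-mod-3 = square-residue 3 (toWitness {a? = all? λ t → Fin.toℕ t * Fin.toℕ t % 3 ℕ.≤? 1} tt)

squares-mod-4 : ∀ n → n * n % 4 ≤ 1
squares-mod-4 = square-residue 4 (toWitness {a? = all? λ t → Fin.toℕ t * Fin.toℕ t % 4 ℕ.≤? 1} tt)

sbgdd₅ : ∀ n → TD 5 n → SBGDD 0 n 5
sbgdd₅ n = periodic-sbgdd design₅ {# 0} {# 1} (λ ()) (toWitness {a? = valid? design₅ (# 0)} tt) (squares-mod-3 n)

sbgdd₆ : ∀ n → TD 6 n → SBGDD 0 n 6
sbgdd₆ n = periodic-sbgdd design₆ {# 0} {# 1} (λ ()) (toWitness {a? = valid? design₆ (# 0)} tt) (squares-mod-4 n)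

sbgdd₈ : ∀ n → TD 8 n → SBGDD 0 n 8
sbgdd₈ n = periodic-sbgdd design₈ {# 0} {# 1} (λ ()) (toWitness {a? = valid? design₈ (# 0)} tt) (squares-mod-3 n)

-- k = 4

-- No multiset of triples on four groups has edge weights {0, …, 5}: their sum 15 is not a
-- multiple of 3.  The blocks with b = 0 receive the missing weight from extra blocks that meet
-- several TD blocks (the families in Four); all other blocks realise {6, …, 11} instead
-- (offset₄) with one uniform copy fewer (periods₄).  The extra blocks also meet the blocks
-- with b = 1, which blockType therefore tells apart from those with b ≥ 2.
blockType : ∀ {n} → Fin n → ℕ
blockType Fin.zero              = 0
blockType (Fin.suc Fin.zero)    = 1
blockType (Fin.suc (Fin.suc _)) = 2

blockType<3 : ∀ {n} (b : Fin n) → blockType b < 3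
blockType<3 Fin.zero              = s≤s z≤n
blockType<3 (Fin.suc Fin.zero)    = s≤s (s≤s z≤n)
blockType<3 (Fin.suc (Fin.suc _)) = s≤s (s≤s (s≤s z≤n))

base₄ : ℕ → Weighted 4
base₄ 0 = (3 , (# 0 , # 1 , # 3)) ∷ (1 , (# 0 , # 1 , # 2)) ∷ []
base₄ 1 = (6 , (# 1 , # 2 , # 3)) ∷ (5 , (# 0 , # 2 , # 3)) ∷ (1 , (# 0 , # 1 , # 3)) ∷ (3 , (# 0 , # 1 , # 2)) ∷ []
base₄ _ = (6 , (# 1 , # 2 , # 3)) ∷ (5 , (# 0 , # 2 , # 3)) ∷ (4 , (# 0 , # 1 , # 3)) ∷ (2 , (# 0 , # 1 , # 2)) ∷ []

inverse₄ : ℕ → List (Fin 4 × Fin 4)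
inverse₄ 0 = (# 2 , # 3) ∷ (# 1 , # 2) ∷ (# 0 , # 2) ∷ (# 1 , # 3) ∷ (# 0 , # 1) ∷ (# 0 , # 3) ∷ []
inverse₄ 1 = (# 0 , # 3) ∷ (# 0 , # 1) ∷ (# 0 , # 2) ∷ (# 1 , # 3) ∷ (# 1 , # 2) ∷ (# 2 , # 3) ∷ []
inverse₄ _ = (# 0 , # 1) ∷ (# 0 , # 2) ∷ (# 1 , # 2) ∷ (# 0 , # 3) ∷ (# 1 , # 3) ∷ (# 2 , # 3) ∷ []

edge₄ : ℕ → ℕ → Fin 4 × Fin 4
edge₄ t s = fromMaybe (# 0 , # 0) (head (drop s (inverse₄ t)))

-- The weight that one extra family through group w gives to the edge {u , v} of a TD block
-- of type t (for u , v ∈ {0 , 1 , w}).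
familyEdge : ℕ → Fin 4 → Fin 4 → ℕ
familyEdge t Fin.zero           (Fin.suc Fin.zero) = ifYes (t ℕ.≟ 1) 1
familyEdge t (Fin.suc Fin.zero) Fin.zero           = ifYes (t ℕ.≟ 1) 1
familyEdge t Fin.zero           _                  = ifYes (t ℕ.≟ 0) 1
familyEdge t _                  Fin.zero           = ifYes (t ℕ.≟ 0) 1
familyEdge t _                  _                  = ifYes (t ℕ.≟ 1) 1

familyWeight : Fin 4 → ℕ → Fin 4 → Fin 4 → ℕ
familyWeight w t u v = ifYes (covers? u v (# 0 , # 1 , w)) (familyEdge t u v)

extraWeight₄ : ℕ → Fin 4 → Fin 4 → ℕ
extraWeight₄ t u v = familyWeight (# 2) t u v + (familyWeight (# 3) t u v + familyWeight (# 3) t u v)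

offset₄ : ℕ → ℕ
offset₄ 0 = 0
offset₄ _ = 6

periods₄ : ℕ → ℕ → ℕ
periods₄ 0 j = j
periods₄ _ j = j ∸ 1

-- Truncated subtraction is harmless: offset₄ t never exceeds the total (valid₄-table).
σ₄ : ℕ → Fin 4 → Fin 4 → ℕ
σ₄ t u v = weight (base₄ t) u v + extraWeight₄ t u v ∸ offset₄ t

valid₄-distinct : ∀ (t : Fin 3) → AllDistinct (base₄ (Fin.toℕ t))
valid₄-distinct = toWitness {a? = all? λ t → All.all? (distinct? ∘ proj₂) (base₄ (Fin.toℕ t))} tt

valid₄-uniform : AllDistinct (uniform {4} 3) × (∀ u v → u ≢ v → weight (uniform {4} 3) u v ≡ 6)
valid₄-uniform = toWitness {a? = All.all? (distinct? ∘ proj₂) (uniform {4} 3) ×-dec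
                                  all? (λ u → all? λ v → ¬? (u Fin.≟ v) →-dec (weight (uniform {4} 3) u v ℕ.≟ 6))} tt

valid₄-table : ∀ (t : Fin 3) u v → u ≢ v →
               offset₄ (Fin.toℕ t) ≤ weight (base₄ (Fin.toℕ t)) u v + extraWeight₄ (Fin.toℕ t) u v ×
               σ₄ (Fin.toℕ t) u v < 6 × SameEdge (edge₄ (Fin.toℕ t) (σ₄ (Fin.toℕ t) u v)) (u , v)
valid₄-table = toWitness {a? = all? λ t → all? λ u → all? λ v → ¬? (u Fin.≟ v) →-dec
  ((offset₄ (Fin.toℕ t) ℕ.≤? weight (base₄ (Fin.toℕ t)) u v + extraWeight₄ (Fin.toℕ t) u v) ×-dec
   (σ₄ (Fin.toℕ t) u v <? 6) ×-dec same-edge? (edge₄ (Fin.toℕ t) (σ₄ (Fin.toℕ t) u v)) (u , v))} tt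

valid₄-inverse : ∀ (t : Fin 3) (s : Fin 6) → let u , v = edge₄ (Fin.toℕ t) (Fin.toℕ s) in
                 u ≢ v × σ₄ (Fin.toℕ t) u v ≡ Fin.toℕ s
valid₄-inverse = toWitness {a? = all? λ t → all? λ s → let u , v = edge₄ (Fin.toℕ t) (Fin.toℕ s) in
  ¬? (u Fin.≟ v) ×-dec (σ₄ (Fin.toℕ t) u v ℕ.≟ Fin.toℕ s)} tt

module Four {n′ : ℕ} (td : TD 4 (suc (suc n′))) where

  private
    n = suc (suc n′)
    one : Fin n
    one = Fin.suc Fin.zero

  open Transversal td
  open Coordinates (# 0) (# 1) (λ ())

  extraPoint : Fin 4 → Fin n → Fin 4 → Fin n
  extraPoint w a Fin.zero              = a
  extraPoint w a (Fin.suc Fin.zero)    = one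
  extraPoint w a (Fin.suc (Fin.suc _)) = point a Fin.zero w

  extraBlock : Fin 4 → Fin n → Block 4 n
  extraBlock w a = lift (extraPoint w a) (# 0 , # 1 , w)

  family : Fin 4 → List (Block 4 n)
  family w = map (extraBlock w) (allFin n)

  module _ (w′ : Fin 2) where

    private
      w : Fin 4
      w = Fin.suc (Fin.suc w′)

    count-family-one : ∀ p q a → p ∈ extraBlock w a → q ∈ extraBlock w a →
                       (∀ {a′} → p ∈ extraBlock w a′ → q ∈ extraBlock w a′ → a′ ≡ a) →
                       count (pair∈? p q) (family w) ≡ 1
    count-family-one p q a p∈ q∈ only =
      trans (count-map (pair∈? p q) (extraBlock w) (allFin n))
            (unique⇒count≡1 (pair∈? p q ∘ extraBlock w) (allFin⁺ n) (∈-allFin a) (p∈ , q∈)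
                            λ _ (p∈′ , q∈′) → only p∈′ q∈′)

    count-family-none : ∀ p q → (∀ {a′} → p ∈ extraBlock w a′ → q ∈ extraBlock w a′ → ⊥) →
                        count (pair∈? p q) (family w) ≡ 0
    count-family-none p q none =
      trans (count-map (pair∈? p q) (extraBlock w) (allFin n))
            (count-none (pair∈? p q ∘ extraBlock w) {allFin n} λ _ (p∈ , q∈) → none p∈ q∈)

    coordinate : ∀ {a′ u x} → (u , x) ∈ extraBlock w a′ → extraPoint w a′ u ≡ x
    coordinate {a′} x∈ = proj₂ (∈-lift⁻ (extraPoint w a′) (# 0 , # 1 , w) x∈)

    count-01 : ∀ a b → count (pair∈? (# 0 , point a b (# 0)) (# 1 , point a b (# 1))) (family w) ≡
                       ifYes (blockType b ℕ.≟ 1) 1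
    count-01 a b rewrite point-g₀ a b | point-g₁ a b with b
    ... | Fin.zero            = count-family-none (# 0 , a) (# 1 , Fin.zero) λ _ 1∈ → case coordinate 1∈ of λ ()
    ... | Fin.suc Fin.zero    = count-family-one (# 0 , a) (# 1 , one) a (here refl) (there (here refl)) λ 0∈ _ →
                                  coordinate 0∈
    ... | Fin.suc (Fin.suc c) = count-family-none (# 0 , a) (# 1 , Fin.suc (Fin.suc c)) λ _ 1∈ →
                                  case coordinate 1∈ of λ ()

    0w∉family : ∀ a b → Fin.zero ≢ b → ∀ {a′} → (# 0 , a) ∈ extraBlock w a′ → (w , point a b w) ∈ extraBlock w a′ → ⊥
    0w∉family a b 0≢b 0∈ w∈ with refl ← coordinate 0∈ =
      0≢b (proj₂ (point-injective (λ ()) (trans (point-g₀ a Fin.zero) (sym (point-g₀ a b))) (coordinate w∈)))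

    count-0w : ∀ a b → count (pair∈? (# 0 , point a b (# 0)) (w , point a b w)) (family w) ≡
                       ifYes (blockType b ℕ.≟ 0) 1
    count-0w a b rewrite point-g₀ a b with b
    ... | Fin.zero            = count-family-one (# 0 , a) (w , point a Fin.zero w) a (here refl)
                                  (there (there (here refl))) λ 0∈ _ → coordinate 0∈
    ... | Fin.suc Fin.zero    = count-family-none (# 0 , a) (w , point a one w) (0w∉family a one λ ())
    ... | Fin.suc (Fin.suc c) = count-family-none (# 0 , a) (w , point a (Fin.suc (Fin.suc c)) w)
                                  (0w∉family a (Fin.suc (Fin.suc c)) λ ())

    count-1w : ∀ a b → count (pair∈? (# 1 , point a b (# 1)) (w , point a b w)) (family w) ≡
                       ifYes (blockType b ℕ.≟ 1) 1
    count-1w a b rewrite point-g₁ a b with b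
    ... | Fin.zero            = count-family-none (# 1 , Fin.zero) (w , point a Fin.zero w) λ 1∈ _ →
                                  case coordinate 1∈ of λ ()
    ... | Fin.suc (Fin.suc c) = count-family-none (# 1 , Fin.suc (Fin.suc c)) (w , point a (Fin.suc (Fin.suc c)) w)
                                  λ 1∈ _ → case coordinate 1∈ of λ ()
    -- The family block is the one indexed by the TD block through (1 , 0) and (w , point a 1 w).
    ... | Fin.suc Fin.zero
      with a″ , b″ , e₁ , e₂ ← point-surjective {# 1} {w} (λ ()) Fin.zero (point a one w)
      with refl ← trans (sym (point-g₁ a″ b″)) e₁ =
      count-family-one (# 1 , one) (w , point a one w) a″ (there (here refl))
        (subst (λ x → (w , x) ∈ extraBlock w a″) e₂ (there (there (here refl))))
        λ _ w∈ → proj₁ (point-injective (λ ()) (trans (point-g₁ _ Fin.zero) (sym (point-g₁ a″ Fin.zero)))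
                                                (trans (coordinate w∈) (sym e₂)))

    count-family : ∀ a b {u v} → u ≢ v →
                   count (pair∈? (u , point a b u) (v , point a b v)) (family w) ≡ familyWeight w (blockType b) u v
    count-family a b {u} {v} u≢v with covers? u v (# 0 , # 1 , w)
    ... | no uv∉ = count-family-none (u , point a b u) (v , point a b v) λ {a′} u∈ v∈ →
                     uv∉ (proj₁ (∈-lift⁻ (extraPoint w a′) (# 0 , # 1 , w) u∈) ,
                          proj₁ (∈-lift⁻ (extraPoint w a′) (# 0 , # 1 , w) v∈))
    ... | yes (inj₁ refl        , inj₂ (inj₁ refl)) = count-01 a b
    ... | yes (inj₁ refl        , inj₂ (inj₂ refl)) = count-0w a b
    ... | yes (inj₂ (inj₁ refl) , inj₂ (inj₂ refl)) = count-1w a b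
    ... | yes (inj₂ (inj₁ refl) , inj₁ refl)        =
      trans (count-pair-swap (# 1 , point a b (# 1)) (# 0 , point a b (# 0)) (family w)) (count-01 a b)
    ... | yes (inj₂ (inj₂ refl) , inj₁ refl)        =
      trans (count-pair-swap (w , point a b w) (# 0 , point a b (# 0)) (family w)) (count-0w a b)
    ... | yes (inj₂ (inj₂ refl) , inj₂ (inj₁ refl)) =
      trans (count-pair-swap (w , point a b w) (# 1 , point a b (# 1)) (family w)) (count-1w a b)
    ... | yes (inj₁ refl        , inj₁ refl)        = ⊥-elim (u≢v refl)
    ... | yes (inj₂ (inj₁ refl) , inj₂ (inj₁ refl)) = ⊥-elim (u≢v refl)
    ... | yes (inj₂ (inj₂ refl) , inj₂ (inj₂ refl)) = ⊥-elim (u≢v refl)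

  extra : List (Block 4 n)
  extra = family (# 2) ++ family (# 3) ++ family (# 3)

  ∈-family⁻ : ∀ {w B} → B ∈ family w → ∃[ a ] B ≡ extraBlock w a
  ∈-family⁻ B∈ = let a , _ , B≡ = ∈-map⁻ _ B∈ in a , B≡

  ∈-extra⁻ : ∀ {B} → B ∈ extra → ∃[ w′ ] ∃[ a ] B ≡ extraBlock (Fin.suc (Fin.suc w′)) a
  ∈-extra⁻ B∈ with ∈-++⁻ (family (# 2)) B∈
  ... | inj₁ B∈₂ = # 0 , ∈-family⁻ B∈₂
  ... | inj₂ B∈₃ with ∈-++⁻ (family (# 3)) B∈₃
  ...   | inj₁ B∈₃′ = # 1 , ∈-family⁻ B∈₃′
  ...   | inj₂ B∈₃′ = # 1 , ∈-family⁻ B∈₃′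

  extra-size : ∀ {B} → B ∈ extra → IsSubsetOfSize 3 B
  extra-size B∈ with w′ , a , refl ← ∈-extra⁻ B∈ = lift-size (extraPoint _ a) ((λ ()) , (λ ()) , (λ ()))

  extra-same : ∀ p q → p ≢ q → group p ≡ group q → freq extra p q ≡ 0
  extra-same (u , x) (.u , y) p≢q refl = count-none (pair∈? (u , x) (u , y)) {extra} λ B∈ (x∈ , y∈) →
    let w′ , a , B≡ = ∈-extra⁻ B∈ in
    p≢q (cong (u ,_) (trans (sym (coordinate w′ (subst (_ ∈_) B≡ x∈))) (coordinate w′ (subst (_ ∈_) B≡ y∈))))

  extra-cross : ∀ a b {u v} → u ≢ v →
                freq extra (u , point a b u) (v , point a b v) ≡ extraWeight₄ (blockType b) u v
  extra-cross a b {u} {v} u≢v =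
    trans (count-++ P? (family (# 2)) (family (# 3) ++ family (# 3)))
          (cong₂ _+_ (count-family (# 0) a b u≢v)
                     (trans (count-++ P? (family (# 3)) (family (# 3)))
                            (cong₂ _+_ (count-family (# 1) a b u≢v) (count-family (# 1) a b u≢v))))
    where P? = pair∈? (u , point a b u) (v , point a b v)

  templates : Fin n → Fin n → Weighted 4
  templates a b = base₄ (blockType b) ++ scale (periods₄ (blockType b) (blockIndex a b)) (uniform 3)

  templates-distinct : ∀ a b → AllDistinct (templates a b)
  templates-distinct a b =
    ++⁺ (below {Q = AllDistinct ∘ base₄} valid₄-distinct (blockType<3 b))
        (scale-distinct (periods₄ (blockType b) (blockIndex a b)) (proj₁ valid₄-uniform))

  index-suc : ∀ (a : Fin n) c → blockIndex a (Fin.suc c) ≡ suc (n * Fin.toℕ a + Fin.toℕ c)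
  index-suc a c = trans (toℕ-combine a (Fin.suc c)) (+-suc (n * Fin.toℕ a) (Fin.toℕ c))

  offset-periods : ∀ (a b : Fin n) →
                   offset₄ (blockType b) + periods₄ (blockType b) (blockIndex a b) * 6 ≡ blockIndex a b * 6
  offset-periods a Fin.zero                                              = refl
  offset-periods a (Fin.suc Fin.zero)    rewrite index-suc a Fin.zero    = refl
  offset-periods a (Fin.suc (Fin.suc c)) rewrite index-suc a (Fin.suc c) = refl

  private
    Table₄ : Fin 4 → Fin 4 → ℕ → Set
    Table₄ u v t = offset₄ t ≤ weight (base₄ t) u v + extraWeight₄ t u v × σ₄ t u v < 6 ×
                   SameEdge (edge₄ t (σ₄ t u v)) (u , v)

    Inverse₄ : ℕ → ℕ → Set
    Inverse₄ t s = proj₁ (edge₄ t s) ≢ proj₂ (edge₄ t s) × σ₄ t (proj₁ (edge₄ t s)) (proj₂ (edge₄ t s)) ≡ s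

    table₄ : ∀ (b : Fin n) {u v} → u ≢ v → Table₄ u v (blockType b)
    table₄ b {u} {v} u≢v = below {Q = Table₄ u v} (λ t → valid₄-table t u v u≢v) (blockType<3 b)

    inverse₄′ : ∀ (b : Fin n) {s} → s < 6 → Inverse₄ (blockType b) s
    inverse₄′ b = below {Q = Inverse₄ (blockType b)}
                        (below {Q = λ t → ∀ (s : Fin 6) → Inverse₄ t (Fin.toℕ s)} valid₄-inverse (blockType<3 b))

    no-last-period : ∀ {r} → r < n * n % 1 → ⊥
    no-last-period {r} r<ρ = n≮0 (subst (r <_) (n%1≡0 (n * n)) r<ρ)

  open Construction.Design td (# 0) (# 1) (λ ()) templates templates-distinct
         extra extra-size extra-same (λ _ b → extraWeight₄ (blockType b)) extra-cross
  open PeriodicLabelling {n} {4} 1 6 (λ _ b → σ₄ (blockType b)) (λ _ → 0) (λ s b → edge₄ (blockType b) s)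
         (λ b _ u≢v → proj₁ (proj₂ (table₄ b u≢v)))
         (λ _ r<1 _ → sym (n<1⇒n≡0 r<1))
         (λ b _ u≢v → proj₂ (proj₂ (table₄ b u≢v)))
         (λ _ → s≤s z≤n)
         (λ b → inverse₄′ b)
         (λ _ r<ρ _ → ⊥-elim (no-last-period r<ρ))
         (λ {s} s<ρ*6 → ⊥-elim (n≮0 (subst (λ ρ → s < ρ * 6) (n%1≡0 (n * n)) s<ρ*6)))

  frequency≡label : ∀ a b {u v} → u ≢ v → frequency a b u v ≡ label a b u v
  frequency≡label a b {u} {v} u≢v = begin
    weight (templates a b) u v + ex                   ≡⟨ cong (_+ ex) (weight-++ (base₄ t) _ u v) ⟩
    (weight (base₄ t) u v + weight (scale p U) u v) + ex
                                                      ≡⟨ cong (λ x → weight (base₄ t) u v + x + ex) uniform-part ⟩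
    weight (base₄ t) u v + p * 6 + ex                 ≡⟨ xy∙z≈xz∙y (weight (base₄ t) u v) (p * 6) ex ⟩
    weight (base₄ t) u v + ex + p * 6                 ≡⟨ cong (_+ p * 6) (sym (m+[n∸m]≡n (proj₁ (table₄ b u≢v)))) ⟩
    offset₄ t + σ₄ t u v + p * 6                      ≡⟨ xy∙z≈y∙xz (offset₄ t) (σ₄ t u v) (p * 6) ⟩
    σ₄ t u v + (offset₄ t + p * 6)                    ≡⟨ cong (σ₄ t u v +_) (offset-periods a b) ⟩
    σ₄ t u v + blockIndex a b * 6                     ≡⟨ cong (λ j → σ₄ t u v + j * 6) (sym (n/1≡n (blockIndex a b))) ⟩
    σ₄ t u v + blockIndex a b / 1 * (1 * 6)           ∎
    where
    open ≡-Reasoning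
    t  = blockType b
    p  = periods₄ t (blockIndex a b)
    U  = uniform {4} 3
    ex = extraWeight₄ t u v
    uniform-part : weight (scale p U) u v ≡ p * 6
    uniform-part = trans (weight-scale p U u v) (cong (p *_) (proj₂ valid₄-uniform u v u≢v))

  sbgdd₄ : SBGDD 0 n 4
  sbgdd₄ = sbgdd (relabel labelling frequency≡label)

sbgdd₄ : ∀ {n} → 1 < n → TD 4 n → SBGDD 0 n 4
sbgdd₄ {suc (suc _)} _  td = Four.sbgdd₄ td
sbgdd₄ {suc zero} (s≤s ()) _

-- Only k = 4 needs n > 1: its extra blocks use the second point of group 1.
lemma5p1 : ∀ (n k : ℕ) → 1 < n →
           (k ≡ 4 ⊎ k ≡ 5 ⊎ k ≡ 6 ⊎ k ≡ 8) →
           TD k n → SBGDD 0 n k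
lemma5p1 n .4 1<n (inj₁ refl)               = sbgdd₄ 1<n
lemma5p1 n .5 _   (inj₂ (inj₁ refl))        = sbgdd₅ n
lemma5p1 n .6 _   (inj₂ (inj₂ (inj₁ refl))) = sbgdd₆ n
lemma5p1 n .8 _   (inj₂ (inj₂ (inj₂ refl))) = sbgdd₈ n
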